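{- Let $t\ge 1$ be an integer and let $\mathcal{DS}(t)$ be the set defined in the context. Define $f(t)=|\mathcal{DS}(t)|$, $g(t)=\sum_{\lambda\in\mathcal{DS}(t)}|MD(\lambda)|$ and $h(t)=\sum_{\lambda\in\mathcal{DS}(t)}|\lambda|$ for $t\ge1$, and set $f(-1)=f(0)=1$, $g(-1)=g(0)=0$, $h(-1)=h(0)=0$. Then: (1) $f(1)=1$, $f(2)=2$, and $f(t)=f(t-1)+f(t-3)$ for all $t\ge 3$; consequently $$\sum_{t\ge0}f(t-1)x^t=\frac{1}{1-x-x^3}.$$ (2) $g(1)=0$, $g(2)=1$, and $$\sum_{t\ge0}g(t-1)x^t=\frac{x^3}{(1-x-x^3)^2}.$$ (3) $h(1)=0$, $h(2)=1$, and $$\sum_{t\ge0}h(t-1)x^t=\frac{(1+4x-x^2+6x^3+4x^4+5x^6)x^3}{(1+x+x^3)(1-x-x^3)^3}.$$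
   Context: A partition $\lambda=(\lambda_1,\dots,\lambda_m)$ is a finite non-increasing sequence of positive integers; $|\lambda|=\sum_i\lambda_i$ is its size; the empty partition $\emptyset$ has size $0$. Its Young diagram has $\lambda_i$ left-justified boxes in row $i$. The hook length of box $(i,j)$ is the number of boxes to its right in row $i$, plus the number of boxes below it in column $j$, plus one. $\lambda$ is a $t$-core if no hook length is divisible by $t$, and a $(t,t+1)$-core if it is both a $t$-core and a $(t+1)$-core. $\lambda$ is self-conjugate if its Young diagram is symmetric about the main diagonal. The Durfee square size $s(\lambda)$ is the largest $s$ such that $\lambda$ has at least $s$ parts $\ge s$. $MD(\lambda)$ denotes the set of hook lengths of the main-diagonal boxes $(i,i)$, $1\le i\le s(\lambda)$ (so $|MD(\lambda)|=s(\lambda)$, and $MD(\emptyset)=\emptyset$). $\mathcal{DS}(t)$ is the set of self-conjugate $(t,t+1)$-core partitions $\lambda$ whose first $s(\lambda)$ parts $\lambda_1,\dots,\lambda_{s(\lambda)}$ are pairwise distinct; by convention $\emptyset\in\mathcal{DS}(t)$. -}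

module Defs where

open import Data.Nat as ℕ using (ℕ; zero; suc; _∸_; _<_; _≤_; _<?_)
open import Data.Nat.Divisibility using (_∣_)
open import Data.Integer as ℤ using (ℤ; +_; 0ℤ; 1ℤ; -1ℤ)
open import Data.List using (List; []; _∷_; length; filter; upTo; map; take)
open import Data.Nat.ListAction using (sum)
open import Data.List.Membership.Propositional using (_∈_)
open import Data.List.Relation.Unary.Unique.Propositional using (Unique)
open import Data.Product using (_×_)
open import Function.Bundles using (_⇔_)
open import Relation.Nullary using (¬_)
open import Relation.Binary.PropositionalEquality using (_≡_)

-- Partitions, represented as lists of parts λ₁ ≥ λ₂ ≥ … ≥ λₘ > 0.
-- Rows and columns are 0-indexed below.

data NonIncreasing : List ℕ → Set where
  ni-[]  : NonIncreasing []
  ni-[x] : ∀ {x} → NonIncreasing (x ∷ [])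
  ni-∷   : ∀ {x y ys} → y ≤ x → NonIncreasing (y ∷ ys) → NonIncreasing (x ∷ y ∷ ys)

data AllPositive : List ℕ → Set where
  ap-[] : AllPositive []
  ap-∷  : ∀ {x xs} → 0 < x → AllPositive xs → AllPositive (x ∷ xs)

IsPartition : List ℕ → Set
IsPartition λ′ = NonIncreasing λ′ × AllPositive λ′

-- i-th part (0-indexed), 0 if there is no such part
part : List ℕ → ℕ → ℕ
part []       _       = 0
part (x ∷ _)  zero    = x
part (_ ∷ xs) (suc i) = part xs i

size : List ℕ → ℕ
size = sum

-- (i , j) is a box of the Young diagram (0-indexed row i, column j)
Box : List ℕ → ℕ → ℕ → Set
Box λ′ i j = j < part λ′ i

colLen : List ℕ → ℕ → ℕ
colLen λ′ j = length (filter (j <?_) λ′)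

-- hook length of box (i , j): arm + leg + 1
hook : List ℕ → ℕ → ℕ → ℕ
hook λ′ i j = (part λ′ i ∸ suc j) ℕ.+ (colLen λ′ j ∸ suc i) ℕ.+ 1

IsCore : ℕ → List ℕ → Set
IsCore t λ′ = ∀ i j → Box λ′ i j → ¬ (t ∣ hook λ′ i j)

SelfConjugate : List ℕ → Set
SelfConjugate λ′ = ∀ i j → Box λ′ i j → Box λ′ j i

-- Durfee square size: for a partition, the largest s with at least s parts ≥ s
-- equals the number of (0-indexed) rows i with λ_{i} ≥ i+1, i.e. diagonal boxes.
durfee : List ℕ → ℕ
durfee λ′ = length (filter (λ i → i <? part λ′ i) (upTo (length λ′)))

MD : List ℕ → List ℕ
MD λ′ = map (λ i → hook λ′ i i) (upTo (durfee λ′))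

DS : ℕ → List ℕ → Set
DS t λ′ = IsPartition λ′ × SelfConjugate λ′ × IsCore t λ′ × IsCore (suc t) λ′
          × Unique (take (durfee λ′) λ′)

Enumerates : (ℕ → List (List ℕ)) → Set
Enumerates E = ∀ t → 1 ≤ t → Unique (E t) × (∀ λ′ → (λ′ ∈ E t) ⇔ DS t λ′)

-- Shifted sequences: fS E n = f(n-1), with f(-1) = f(0) = 1, etc.

fS : (ℕ → List (List ℕ)) → ℕ → ℕ
fS E zero          = 1
fS E (suc zero)    = 1
fS E (suc (suc t)) = length (E (suc t))

gS : (ℕ → List (List ℕ)) → ℕ → ℕ
gS E zero          = 0
gS E (suc zero)    = 0
gS E (suc (suc t)) = sum (map (λ λ′ → length (MD λ′)) (E (suc t)))

hS : (ℕ → List (List ℕ)) → ℕ → ℕ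
hS E zero          = 0
hS E (suc zero)    = 0
hS E (suc (suc t)) = sum (map size (E (suc t)))

-- Formal power series over ℤ as coefficient functions ℕ → ℤ;
-- polynomials as coefficient lists (constant term first).

Series : Set
Series = ℕ → ℤ

coeff : List ℤ → Series
coeff []       _       = 0ℤ
coeff (p ∷ _)  zero    = p
coeff (_ ∷ ps) (suc n) = coeff ps n

_·ₛ_ : List ℤ → Series → Series
([]     ·ₛ a) n       = 0ℤ
((p ∷ ps) ·ₛ a) zero    = p ℤ.* a zero
((p ∷ ps) ·ₛ a) (suc n) = p ℤ.* a (suc n) ℤ.+ (ps ·ₛ a) n

_+ₚ_ : List ℤ → List ℤ → List ℤ
[]       +ₚ qs       = qs
(p ∷ ps) +ₚ []       = p ∷ ps
(p ∷ ps) +ₚ (q ∷ qs) = (p ℤ.+ q) ∷ (ps +ₚ qs)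

_*ₚ_ : List ℤ → List ℤ → List ℤ
[]       *ₚ qs = []
(p ∷ ps) *ₚ qs = map (p ℤ.*_) qs +ₚ (0ℤ ∷ (ps *ₚ qs))

toℤ : (ℕ → ℕ) → Series
toℤ a n = + a n

D₋ : List ℤ
D₋ = 1ℤ ∷ -1ℤ ∷ 0ℤ ∷ -1ℤ ∷ []

D₊ : List ℤ
D₊ = 1ℤ ∷ 1ℤ ∷ 0ℤ ∷ 1ℤ ∷ []

X³ : List ℤ
X³ = 0ℤ ∷ 0ℤ ∷ 0ℤ ∷ 1ℤ ∷ []

N₃ : List ℤ
N₃ = + 1 ∷ + 4 ∷ -1ℤ ∷ + 6 ∷ + 4 ∷ 0ℤ ∷ + 5 ∷ []

module Submission where

-- A self-conjugate λ whose diagonal parts are distinct is determined by the arm lengths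
-- p₀ > p₁ > … of its diagonal boxes, and these satisfy pᵢ₊₁ + 2 ≤ pᵢ.  The box (i , j) of the
-- Durfee square has hook length pᵢ + pⱼ + 1, every other box a hook length at most some pᵢ, and
-- λ₁ ≤ t for λ ∈ DS(t).  So λ ∈ DS(t) iff all pᵢ < t and no pᵢ + pⱼ + 1 is t or t + 1; moreover
-- |MD(λ)| is the number of arms and |λ| = Σ (2pᵢ + 1).
-- An admissible arm sequence for t + 3 either ends in 0, and then dropping the 0 and replacing the
-- sequence by (t + 1 - pₙ₋₁ , … , t + 1 - p₀) gives one for t, or has positive parts, and then the
-- same reflection with t + 2 gives one for t + 2.  Hence f(t + 3) = f(t + 2) + f(t),
-- g(t + 3) = g(t + 2) + g(t) + f(t) and h(t + 3) + h(t + 2) + h(t) = (2t + 6) g(t + 2) + (2t + 4) g(t) + f(t),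
-- and the generating functions follow by multiplying out with 1 - x - x³ and 1 + x + x³.

module Partitions where

  open import Data.Nat using (ℕ; zero; suc; _+_; _*_; _∸_; _<_; _≤_; _<?_; z≤n; s≤s)
  open import Data.Nat.Properties
  open import Data.Nat.Divisibility using (_∣_; divides)
  open import Data.Nat.Tactic.RingSolver using (solve-∀)
  open import Data.List using (List; []; _∷_; length; filter; upTo; take; applyUpTo)
  open import Data.List.Properties using (length-filter; length-upTo)
  import Data.List.Relation.Unary.All.Properties as All
  open import Data.List.Relation.Unary.AllPairs using (_∷_)
  open import Data.List.Relation.Unary.Unique.Propositional using (Unique)
  open import Data.Product using (_×_; _,_; proj₂)
  open import Data.Empty using (⊥-elim)
  open import Function using (_∘_; id)
  open import Level using (0ℓ)
  open import Relation.Binary using (tri<; tri≈; tri>)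
  open import Relation.Binary.PropositionalEquality
  open import Relation.Nullary using (yes; no)
  open import Relation.Unary using (Pred; Decidable)
  open import Defs

  <-extensional : ∀ {m n} → (∀ {k} → k < m → k < n) → (∀ {k} → k < n → k < m) → m ≡ n
  <-extensional {m} {n} m⊆n n⊆m with <-cmp m n
  ... | tri< m<n _ _ = ⊥-elim (<-irrefl refl (n⊆m m<n))
  ... | tri≈ _ m≡n _ = m≡n
  ... | tri> _ _ n<m = ⊥-elim (<-irrefl refl (m⊆n n<m))

  ≤-from-< : ∀ {m n} → (∀ {k} → k < m → k < n) → m ≤ n
  ≤-from-< {zero}  _   = z≤n
  ≤-from-< {suc m} m⊆n = m⊆n ≤-refl

  ∸-swap-sum : ∀ {a b i j} → suc j ≤ a + suc i → suc i ≤ b + suc j →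
               (a + suc i ∸ suc j) + (b + suc j ∸ suc i) ≡ a + b
  ∸-swap-sum {a} {b} {i} {j} j<aᵢ i<bⱼ = +-cancelʳ-≡ (suc i + suc j) _ _ (begin
    (a + suc i ∸ suc j) + (b + suc j ∸ suc i) + (suc i + suc j)
      ≡⟨ shuffle (a + suc i ∸ suc j) (b + suc j ∸ suc i) i j ⟩
    ((a + suc i ∸ suc j) + suc j) + ((b + suc j ∸ suc i) + suc i)
      ≡⟨ cong₂ _+_ (m∸n+n≡m j<aᵢ) (m∸n+n≡m i<bⱼ) ⟩
    (a + suc i) + (b + suc j)
      ≡⟨ shuffle′ a b i j ⟩
    a + b + (suc i + suc j) ∎)
    where
    open ≡-Reasoning
    shuffle : ∀ u v i j → u + v + (suc i + suc j) ≡ (u + suc j) + (v + suc i)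
    shuffle = solve-∀
    shuffle′ : ∀ a b i j → (a + suc i) + (b + suc j) ≡ a + b + (suc i + suc j)
    shuffle′ = solve-∀

  ∸-sum-≤ : ∀ {a c i j} → suc j ≤ a + suc i → suc i ≤ c → c ≤ j → (a + suc i ∸ suc j) + (c ∸ suc i) + 1 ≤ a
  ∸-sum-≤ {a} {c} {i} {j} j<aᵢ i<c c≤j = +-cancelʳ-≤ (suc i + suc j) _ _ (begin
    (a + suc i ∸ suc j) + (c ∸ suc i) + 1 + (suc i + suc j)
      ≡⟨ shuffle (a + suc i ∸ suc j) (c ∸ suc i) i j ⟩
    ((a + suc i ∸ suc j) + suc j) + ((c ∸ suc i) + suc i) + 1
      ≡⟨ cong₂ (λ x y → x + y + 1) (m∸n+n≡m j<aᵢ) (m∸n+n≡m i<c) ⟩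
    (a + suc i) + c + 1
      ≤⟨ +-monoˡ-≤ 1 (+-monoʳ-≤ (a + suc i) c≤j) ⟩
    (a + suc i) + j + 1
      ≡⟨ shuffle′ a i j ⟩
    a + (suc i + suc j) ∎)
    where
    open ≤-Reasoning
    shuffle : ∀ u v i j → u + v + 1 + (suc i + suc j) ≡ (u + suc j) + (v + suc i) + 1
    shuffle = solve-∀
    shuffle′ : ∀ a i j → (a + suc i) + j + 1 ≡ a + (suc i + suc j)
    shuffle′ = solve-∀

  multiple-below-double : ∀ {c h} → c ∣ h → 0 < h → h < c + c → h ≡ c
  multiple-below-double (divides zero h≡0) h>0 _ = ⊥-elim (<-irrefl (sym h≡0) h>0)
  multiple-below-double {c} (divides 1 h≡c) _ _ = trans h≡c (+-identityʳ c)
  multiple-below-double {c} (divides (suc (suc q)) refl) _ h<2c =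
    ⊥-elim (<-irrefl refl (<-≤-trans h<2c (+-monoʳ-≤ c (m≤m+n c (q * c)))))

  part-applyUpTo : ∀ f n {i} → i < n → part (applyUpTo f n) i ≡ f i
  part-applyUpTo f (suc n) {zero}  _         = refl
  part-applyUpTo f (suc n) {suc i} (s≤s i<n) = part-applyUpTo (f ∘ suc) n i<n

  part-applyUpTo-≥ : ∀ f n {i} → n ≤ i → part (applyUpTo f n) i ≡ 0
  part-applyUpTo-≥ f zero    _         = refl
  part-applyUpTo-≥ f (suc n) (s≤s n≤i) = part-applyUpTo-≥ (f ∘ suc) n n≤i

  applyUpTo-part : ∀ xs → applyUpTo (part xs) (length xs) ≡ xs
  applyUpTo-part []       = refl
  applyUpTo-part (x ∷ xs) = cong (x ∷_) (applyUpTo-part xs)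

  applyUpTo-cong : ∀ {f g : ℕ → ℕ} n → (∀ {i} → i < n → f i ≡ g i) → applyUpTo f n ≡ applyUpTo g n
  applyUpTo-cong zero    f≗g = refl
  applyUpTo-cong (suc n) f≗g = cong₂ _∷_ (f≗g (s≤s z≤n)) (applyUpTo-cong n (f≗g ∘ s≤s))

  part-extensional : ∀ {xs ys} → length xs ≡ length ys →
                     (∀ {i} → i < length xs → part xs i ≡ part ys i) → xs ≡ ys
  part-extensional {xs} {ys} |xs|≡|ys| xs≗ys = begin
    xs                                  ≡⟨ applyUpTo-part xs ⟨
    applyUpTo (part xs) (length xs)     ≡⟨ applyUpTo-cong (length xs) xs≗ys ⟩
    applyUpTo (part ys) (length xs)     ≡⟨ cong (applyUpTo (part ys)) |xs|≡|ys| ⟩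
    applyUpTo (part ys) (length ys)     ≡⟨ applyUpTo-part ys ⟩
    ys                                  ∎
    where open ≡-Reasoning

  part-injective : ∀ {xs ys} → AllPositive xs → AllPositive ys → (∀ i → part xs i ≡ part ys i) → xs ≡ ys
  part-injective ap-[]          ap-[]          _     = refl
  part-injective ap-[]          (ap-∷ y>0 _)   xs≗ys = ⊥-elim (<-irrefl (xs≗ys 0) y>0)
  part-injective (ap-∷ x>0 _)   ap-[]          xs≗ys = ⊥-elim (<-irrefl (sym (xs≗ys 0)) x>0)
  part-injective (ap-∷ _ xs>0) (ap-∷ _ ys>0) xs≗ys = cong₂ _∷_ (xs≗ys 0) (part-injective xs>0 ys>0 (xs≗ys ∘ suc))

  take-applyUpTo-part : ∀ xs {n} → n ≤ length xs → take n xs ≡ applyUpTo (part xs) n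
  take-applyUpTo-part xs       {zero}  _         = refl
  take-applyUpTo-part (x ∷ xs) {suc n} (s≤s n≤∣xs∣) = cong (x ∷_) (take-applyUpTo-part xs n≤∣xs∣)

  part-≥length : ∀ xs {i} → length xs ≤ i → part xs i ≡ 0
  part-≥length []       _         = refl
  part-≥length (x ∷ xs) (s≤s ∣xs∣≤i) = part-≥length xs ∣xs∣≤i

  part>0⇒<length : ∀ xs {i} → 0 < part xs i → i < length xs
  part>0⇒<length (x ∷ xs) {zero}  _   = s≤s z≤n
  part>0⇒<length (x ∷ xs) {suc i} pos = s≤s (part>0⇒<length xs pos)

  <length⇒part>0 : ∀ {xs} → AllPositive xs → ∀ {i} → i < length xs → 0 < part xs i
  <length⇒part>0 (ap-∷ x>0 _)   {zero}  _         = x>0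
  <length⇒part>0 (ap-∷ _ xs>0) {suc i} (s≤s i<n) = <length⇒part>0 xs>0 i<n

  nonIncreasing-tail : ∀ {x xs} → NonIncreasing (x ∷ xs) → NonIncreasing xs
  nonIncreasing-tail ni-[x]     = ni-[]
  nonIncreasing-tail (ni-∷ _ p) = p

  part≤head : ∀ {x xs} → NonIncreasing (x ∷ xs) → ∀ k → part (x ∷ xs) k ≤ x
  part≤head _            zero    = ≤-refl
  part≤head ni-[x]       (suc k) = z≤n
  part≤head (ni-∷ y≤x p) (suc k) = ≤-trans (part≤head p k) y≤x

  part-antitone : ∀ {xs} → NonIncreasing xs → ∀ {i j} → i ≤ j → part xs j ≤ part xs i
  part-antitone {[]}     _ _         = z≤n
  part-antitone {x ∷ xs} p {zero} {j} _ = part≤head p j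
  part-antitone {x ∷ xs} p {suc i} {suc j} (s≤s i≤j) = part-antitone (nonIncreasing-tail p) i≤j

  nonIncreasing-applyUpTo : ∀ f n → (∀ {i} → suc i < n → f (suc i) ≤ f i) → NonIncreasing (applyUpTo f n)
  nonIncreasing-applyUpTo f zero          _ = ni-[]
  nonIncreasing-applyUpTo f (suc zero)    _ = ni-[x]
  nonIncreasing-applyUpTo f (suc (suc n)) f↓ =
    ni-∷ (f↓ (s≤s (s≤s z≤n))) (nonIncreasing-applyUpTo (f ∘ suc) (suc n) (f↓ ∘ s≤s))

  allPositive-applyUpTo : ∀ f n → (∀ {i} → i < n → 0 < f i) → AllPositive (applyUpTo f n)
  allPositive-applyUpTo f zero    _   = ap-[]
  allPositive-applyUpTo f (suc n) f>0 = ap-∷ (f>0 (s≤s z≤n)) (allPositive-applyUpTo (f ∘ suc) n (f>0 ∘ s≤s))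

  Unique-applyUpTo⁻ : ∀ (f : ℕ → ℕ) n → Unique (applyUpTo f n) → ∀ {i j} → i < j → j < n → f i ≢ f j
  Unique-applyUpTo⁻ f (suc n) (f0∉ ∷ _) {zero} {suc j} _ (s≤s j<n) = All.applyUpTo⁻ (f ∘ suc) n f0∉ j<n
  Unique-applyUpTo⁻ f (suc n) (_ ∷ u) {suc i} {suc j} (s≤s i<j) (s≤s j<n) =
    Unique-applyUpTo⁻ (f ∘ suc) n u i<j j<n

  module _ {P : Pred ℕ 0ℓ} (P? : Decidable P) where

    PrefixClosed : List ℕ → Set
    PrefixClosed xs = ∀ {i j} → i ≤ j → j < length xs → P (part xs j) → P (part xs i)

    private
      prefixClosed-tail : ∀ {x xs} → PrefixClosed (x ∷ xs) → PrefixClosed xs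
      prefixClosed-tail closed i≤j j<n = closed (s≤s i≤j) (s≤s j<n)

    <length-filter⁻ : ∀ xs → PrefixClosed xs → ∀ {k} → k < length (filter P? xs) →
                      k < length xs × P (part xs k)
    <length-filter⁻ (x ∷ xs) closed {k} k<∣f∣ with P? x
    ... | yes px with k
    ...   | zero  = s≤s z≤n , px
    ...   | suc k = let k<n , pk = <length-filter⁻ xs (prefixClosed-tail closed) (≤-pred k<∣f∣) in s≤s k<n , pk
    <length-filter⁻ (x ∷ xs) closed {k} k<∣f∣ | no ¬px =
      let k<n , pk = <length-filter⁻ xs (prefixClosed-tail closed) k<∣f∣
      in ⊥-elim (¬px (closed {zero} {suc k} z≤n (s≤s k<n) pk))

    <length-filter⁺ : ∀ xs → PrefixClosed xs → ∀ {k} → k < length xs → P (part xs k) →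
                      k < length (filter P? xs)
    <length-filter⁺ (x ∷ xs) closed {k} k<n pk with P? x
    <length-filter⁺ (x ∷ xs) closed {zero}  k<n pk | yes px = s≤s z≤n
    <length-filter⁺ (x ∷ xs) closed {suc k} k<n pk | yes px =
      s≤s (<length-filter⁺ xs (prefixClosed-tail closed) (≤-pred k<n) pk)
    <length-filter⁺ (x ∷ xs) closed {k} k<n pk | no ¬px = ⊥-elim (¬px (closed z≤n k<n pk))

  hook>0 : ∀ xs i j → 0 < hook xs i j
  hook>0 xs i j = m≤n+m 1 _

  module _ {xs : List ℕ} (xs↓ : NonIncreasing xs) where

    private
      column-prefixClosed : ∀ j → PrefixClosed (j <?_) xs
      column-prefixClosed j i≤k _ j<xsₖ = <-≤-trans j<xsₖ (part-antitone xs↓ i≤k)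

    <colLen⇒<part : ∀ {j k} → k < colLen xs j → j < part xs k
    <colLen⇒<part {j} = proj₂ ∘ <length-filter⁻ (j <?_) xs (column-prefixClosed j)

    <part⇒<colLen : ∀ {j k} → j < part xs k → k < colLen xs j
    <part⇒<colLen {j} j<xsₖ =
      <length-filter⁺ (j <?_) xs (column-prefixClosed j) (part>0⇒<length xs (≤-<-trans z≤n j<xsₖ)) j<xsₖ

    colLen≡part : SelfConjugate xs → ∀ j → colLen xs j ≡ part xs j
    colLen≡part sc j = <-extensional (λ k<c → sc _ j (<colLen⇒<part k<c)) (λ k<xsⱼ → <part⇒<colLen (sc j _ k<xsⱼ))

    hook≡ : SelfConjugate xs → ∀ i j → hook xs i j ≡ (part xs i ∸ suc j) + (part xs j ∸ suc i) + 1
    hook≡ sc i j = cong (λ c → (part xs i ∸ suc j) + (c ∸ suc i) + 1) (colLen≡part sc j)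

    private
      OnDiagonal : Pred ℕ 0ℓ
      OnDiagonal k = k < part xs k

      onDiagonal? : Decidable OnDiagonal
      onDiagonal? k = k <? part xs k

      indices : List ℕ
      indices = upTo (length xs)

      <length-indices : ∀ {k} → k < length indices → k < length xs
      <length-indices {k} = subst (k <_) (length-upTo (length xs))

      part-indices : ∀ {k} → k < length xs → part indices k ≡ k
      part-indices = part-applyUpTo id (length xs)

      diagonal-prefixClosed : PrefixClosed onDiagonal? indices
      diagonal-prefixClosed {i} {j} i≤j j<n onDiagonal-j =
        subst OnDiagonal (sym (part-indices (≤-<-trans i≤j (<length-indices j<n))))
          (≤-<-trans i≤j (<-≤-trans (subst OnDiagonal (part-indices (<length-indices j<n)) onDiagonal-j)
                                    (part-antitone xs↓ i≤j)))

    <durfee⇒<part : ∀ {k} → k < durfee xs → k < part xs k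
    <durfee⇒<part k<s =
      let k<n , k<xsₖ = <length-filter⁻ onDiagonal? indices diagonal-prefixClosed k<s
      in subst OnDiagonal (part-indices (<length-indices k<n)) k<xsₖ

    <part⇒<durfee : ∀ {k} → k < part xs k → k < durfee xs
    <part⇒<durfee {k} k<xsₖ = <length-filter⁺ onDiagonal? indices diagonal-prefixClosed
      (subst (k <_) (sym (length-upTo (length xs))) k<n)
      (subst OnDiagonal (sym (part-indices k<n)) k<xsₖ)
      where
      k<n : k < length xs
      k<n = part>0⇒<length xs (≤-<-trans z≤n k<xsₖ)

  durfee≤length : ∀ xs → durfee xs ≤ length xs
  durfee≤length xs = ≤-trans (length-filter _ (upTo (length xs))) (≤-reflexive (length-upTo (length xs)))


module ArmSequences where

  open import Data.Bool using (true; false; if_then_else_)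
  open import Data.Nat using (NonZero; >-nonZero; ℕ; suc; _+_; _∸_; _<_; _<ᵇ_; _≤_; _<?_; _≤?_; z≤n; s≤s)
  open import Data.Nat.Properties
  open import Function using (_∘_)
  open import Data.Nat.Divisibility using (∣⇒≤)
  open import Data.Nat.Tactic.RingSolver using (solve-∀)
  open import Data.List using (List; length; upTo; take; applyUpTo)
  open import Data.List.Properties using (length-applyUpTo; length-map)
  open import Data.List.Relation.Unary.Unique.Propositional using (Unique)
  open import Data.List.Relation.Unary.Unique.Propositional.Properties using (applyUpTo⁺₁)
  open import Data.Product using (_×_; _,_; proj₁; proj₂)
  open import Data.Empty using (⊥-elim)
  open import Data.Sum using (_⊎_; inj₁; inj₂)
  open import Relation.Nullary using (yes; no)
  open import Relation.Binary.PropositionalEquality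
  open import Defs
  open Partitions

  -- P lists the arm lengths pᵢ = λᵢ - (i + 1) of the diagonal boxes of a self-conjugate λ, so that
  -- the diagonal parts are distinct iff pᵢ₊₁ + 2 ≤ pᵢ, and the box (i , j) of the Durfee square
  -- has hook length pᵢ + pⱼ + 1.
  Gapped : List ℕ → Set
  Gapped P = ∀ i → suc i < length P → part P (suc i) + 2 ≤ part P i

  record Admissible (t : ℕ) (P : List ℕ) : Set where
    field
      gap      : Gapped P
      bounded  : ∀ i → i < length P → part P i < t
      hook≢t   : ∀ i j → i < length P → j < length P → suc (part P i + part P j) ≢ t
      hook≢1+t : ∀ i j → i < length P → j < length P → part P i + part P j ≢ t

  arms : List ℕ → List ℕ
  arms λ′ = applyUpTo (λ i → part λ′ i ∸ suc i) (durfee λ′)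

  module FromArms (P : List ℕ) where

    s : ℕ
    s = length P

    row : ℕ → ℕ
    row i = part P i + suc i

    rows : List ℕ
    rows = applyUpTo row s

    height : ℕ
    height = part rows 0

    -- Below the Durfee square the rows of a self-conjugate shape are the columns of the rows above.
    shapePart : ℕ → ℕ
    shapePart i = if i <ᵇ s then row i else colLen rows i

    shape : List ℕ
    shape = applyUpTo shapePart height

    shapePart-< : ∀ {i} → i < s → shapePart i ≡ row i
    shapePart-< {i} i<s with i <ᵇ s | <⇒<ᵇ i<s
    ... | true  | _  = refl
    ... | false | ()

    shapePart-≥ : ∀ {i} → s ≤ i → shapePart i ≡ colLen rows i
    shapePart-≥ {i} s≤i with i <ᵇ s | <ᵇ⇒< i s
    ... | false | _   = refl
    ... | true  | i<s = ⊥-elim (<⇒≱ (i<s _) s≤i)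

    part-rows-< : ∀ {k} → k < s → part rows k ≡ row k
    part-rows-< = part-applyUpTo row s

    part-rows-≥ : ∀ {k} → s ≤ k → part rows k ≡ 0
    part-rows-≥ = part-applyUpTo-≥ row s

    i<row : ∀ i → i < row i
    i<row i = m≤n+m (suc i) (part P i)

  fromArms : List ℕ → List ℕ
  fromArms = FromArms.shape

  module FromAdmissible {t P} (adm : Admissible t P) where

    open FromArms P public
    open Admissible adm

    row-suc< : ∀ i → suc i < s → row (suc i) < row i
    row-suc< i 1+i<s = begin-strict
      part P (suc i) + suc (suc i) ≡⟨ shuffle (part P (suc i)) i ⟩
      part P (suc i) + 2 + i       ≤⟨ +-monoˡ-≤ i (gap i 1+i<s) ⟩
      part P i + i                 <⟨ +-monoʳ-< (part P i) (n<1+n i) ⟩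
      part P i + suc i             ∎
      where
      open ≤-Reasoning
      shuffle : ∀ x i → x + suc (suc i) ≡ x + 2 + i
      shuffle = solve-∀

    row-decreasing : ∀ {i j} → i < j → j < s → row j < row i
    row-decreasing {i} {suc j} (s≤s i≤j) 1+j<s with m≤n⇒m<n∨m≡n i≤j
    ... | inj₁ i<j  = <-trans (row-suc< j 1+j<s) (row-decreasing i<j (<-trans (n<1+n j) 1+j<s))
    ... | inj₂ refl = row-suc< i 1+j<s

    row-antitone : ∀ {i j} → i ≤ j → j < s → row j ≤ row i
    row-antitone i≤j j<s with m≤n⇒m<n∨m≡n i≤j
    ... | inj₁ i<j  = <⇒≤ (row-decreasing i<j j<s)
    ... | inj₂ refl = ≤-refl

    s≤row : ∀ {i} → i < s → s ≤ row i
    s≤row {i} i<s = ≤-from-< below-row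
      where
      below-row : ∀ {j} → j < s → j < row i
      below-row {j} j<s with i ≤? j
      ... | yes i≤j = <-≤-trans (i<row j) (row-antitone i≤j j<s)
      ... | no  i≰j = <-trans (≰⇒> i≰j) (i<row i)

    rows↓ : NonIncreasing rows
    rows↓ = nonIncreasing-applyUpTo row s (λ 1+i<s → <⇒≤ (row-suc< _ 1+i<s))

    <colLen-rows⇒ : ∀ {j k} → k < colLen rows j → k < s × j < row k
    <colLen-rows⇒ {j} {k} k<c with k <? s
    ... | yes k<s = k<s , subst (j <_) (part-rows-< k<s) (<colLen⇒<part rows↓ k<c)
    ... | no  k≮s = ⊥-elim (n≮0 (subst (j <_) (part-rows-≥ (≮⇒≥ k≮s)) (<colLen⇒<part rows↓ k<c)))

    <colLen-rows⇐ : ∀ {j k} → k < s → j < row k → k < colLen rows j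
    <colLen-rows⇐ k<s j<rowₖ = <part⇒<colLen rows↓ (subst (_ <_) (sym (part-rows-< k<s)) j<rowₖ)

    colLen-rows≤s : ∀ j → colLen rows j ≤ s
    colLen-rows≤s j = ≤-from-< (proj₁ ∘ <colLen-rows⇒)

    height≡row0 : 0 < s → height ≡ row 0
    height≡row0 = part-rows-<

    shapePart-≥height : ∀ {i} → height ≤ i → shapePart i ≡ 0
    shapePart-≥height {i} height≤i with i <? s
    ... | yes i<s = ⊥-elim (<⇒≱ i<s (≤-trans (s≤row s>0) (subst (_≤ i) (height≡row0 s>0) height≤i)))
      where
      s>0 : 0 < s
      s>0 = ≤-<-trans z≤n i<s
    ... | no  i≮s = trans (shapePart-≥ (≮⇒≥ i≮s)) (n≤0⇒n≡0 (≤-from-< k<c⇒⊥))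
      where
      k<c⇒⊥ : ∀ {k} → k < colLen rows i → k < 0
      k<c⇒⊥ k<c with <colLen-rows⇒ k<c
      ... | k<s , i<rowₖ = ⊥-elim (<⇒≱ i<rowₖ (≤-trans (row-antitone z≤n k<s)
                             (subst (_≤ i) (height≡row0 (≤-<-trans z≤n k<s)) height≤i)))

    part-shape : ∀ i → part shape i ≡ shapePart i
    part-shape i with i <? height
    ... | yes i<h = part-applyUpTo shapePart height i<h
    ... | no  i≮h = trans (part-applyUpTo-≥ shapePart height (≮⇒≥ i≮h)) (sym (shapePart-≥height (≮⇒≥ i≮h)))

    shapePart-suc≤ : ∀ i → shapePart (suc i) ≤ shapePart i
    shapePart-suc≤ i with suc i <? s | i <? s
    ... | yes 1+i<s | _ = subst₂ _≤_ (sym (shapePart-< 1+i<s)) (sym (shapePart-< (<-trans (n<1+n i) 1+i<s)))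
                            (<⇒≤ (row-suc< i 1+i<s))
    ... | no 1+i≮s | yes i<s = subst₂ _≤_ (sym (shapePart-≥ (≮⇒≥ 1+i≮s))) (sym (shapePart-< i<s))
                                 (≤-trans (colLen-rows≤s (suc i)) (s≤row i<s))
    ... | no 1+i≮s | no i≮s = subst₂ _≤_ (sym (shapePart-≥ (≮⇒≥ 1+i≮s))) (sym (shapePart-≥ (≮⇒≥ i≮s)))
                                (≤-from-< λ k<c → let k<s , 1+i<rowₖ = <colLen-rows⇒ k<c
                                                  in <colLen-rows⇐ k<s (<-trans (n<1+n i) 1+i<rowₖ))

    shapePart>0 : ∀ {i} → i < height → 0 < shapePart i
    shapePart>0 {i} i<h with i <? s | 0 <? s
    ... | yes i<s | _       = subst (0 <_) (sym (shapePart-< i<s)) (≤-<-trans z≤n (i<row i))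
    ... | no i≮s  | yes s>0 = subst (0 <_) (sym (shapePart-≥ (≮⇒≥ i≮s)))
                                (<colLen-rows⇐ s>0 (subst (i <_) (height≡row0 s>0) i<h))
    ... | no i≮s  | no s≯0  = ⊥-elim (n≮0 (subst (i <_) (part-rows-≥ (≮⇒≥ s≯0)) i<h))

    shape-isPartition : IsPartition shape
    shape-isPartition = nonIncreasing-applyUpTo shapePart height (λ {i} _ → shapePart-suc≤ i)
                      , allPositive-applyUpTo shapePart height shapePart>0

    shapePart-selfConjugate : ∀ i j → j < shapePart i → i < shapePart j
    shapePart-selfConjugate i j j<λᵢ with i <? s | j <? s
    ... | yes i<s | yes j<s = subst (i <_) (sym (shapePart-< j<s)) (<-≤-trans i<s (s≤row j<s))
    ... | yes i<s | no j≮s  = subst (i <_) (sym (shapePart-≥ (≮⇒≥ j≮s)))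
                                (<colLen-rows⇐ i<s (subst (j <_) (shapePart-< i<s) j<λᵢ))
    ... | no i≮s  | yes j<s = subst (i <_) (sym (shapePart-< j<s))
                                (proj₂ (<colLen-rows⇒ (subst (j <_) (shapePart-≥ (≮⇒≥ i≮s)) j<λᵢ)))
    ... | no i≮s  | no j≮s  = ⊥-elim (<⇒≱ (subst (j <_) (shapePart-≥ (≮⇒≥ i≮s)) j<λᵢ)
                                          (≤-trans (colLen-rows≤s i) (≮⇒≥ j≮s)))

    shape-selfConjugate : SelfConjugate shape
    shape-selfConjugate i j j<λᵢ =
      subst (i <_) (sym (part-shape j)) (shapePart-selfConjugate i j (subst (j <_) (part-shape i) j<λᵢ))

    shape↓ : NonIncreasing shape
    shape↓ = proj₁ shape-isPartition

    part-shape-< : ∀ {i} → i < s → part shape i ≡ row i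
    part-shape-< i<s = trans (part-shape _) (shapePart-< i<s)

    durfee-shape : durfee shape ≡ s
    durfee-shape = <-extensional
      (λ {k} k<d → on-diagonal⇒<s (subst (k <_) (part-shape k) (<durfee⇒<part shape↓ k<d)))
      (λ {k} k<s → <part⇒<durfee shape↓ (subst (k <_) (sym (part-shape-< k<s)) (i<row k)))
      where
      on-diagonal⇒<s : ∀ {k} → k < shapePart k → k < s
      on-diagonal⇒<s {k} k<λₖ with k <? s
      ... | yes k<s = k<s
      ... | no k≮s = ⊥-elim (<⇒≱ (subst (k <_) (shapePart-≥ (≮⇒≥ k≮s)) k<λₖ)
                                  (≤-trans (colLen-rows≤s k) (≮⇒≥ k≮s)))

    s≤height : s ≤ height
    s≤height with 0 <? s
    ... | yes s>0 = subst (s ≤_) (sym (height≡row0 s>0)) (s≤row s>0)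
    ... | no s≯0  = subst (_≤ height) (sym (n≤0⇒n≡0 (≮⇒≥ s≯0))) z≤n

    take-durfee-shape : take (durfee shape) shape ≡ applyUpTo row s
    take-durfee-shape = begin
      take (durfee shape) shape    ≡⟨ cong (λ d → take d shape) durfee-shape ⟩
      take s shape                 ≡⟨ take-applyUpTo-part shape (subst (s ≤_) (sym (length-applyUpTo _ height)) s≤height) ⟩
      applyUpTo (part shape) s     ≡⟨ applyUpTo-cong s part-shape-< ⟩
      applyUpTo row s              ∎
      where open ≡-Reasoning

    diagonal-distinct : Unique (take (durfee shape) shape)
    diagonal-distinct = subst Unique (sym take-durfee-shape)
      (applyUpTo⁺₁ row s (λ i<j j<s rowᵢ≡rowⱼ → <-irrefl (sym rowᵢ≡rowⱼ) (row-decreasing i<j j<s)))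

    arms-shape : arms shape ≡ P
    arms-shape = begin
      applyUpTo (λ i → part shape i ∸ suc i) (durfee shape) ≡⟨ cong (applyUpTo _) durfee-shape ⟩
      applyUpTo (λ i → part shape i ∸ suc i) s             ≡⟨ applyUpTo-cong s (λ {i} i<s → trans (cong (_∸ suc i) (part-shape-< i<s)) (m+n∸n≡m (part P i) (suc i))) ⟩
      applyUpTo (part P) s                                 ≡⟨ applyUpTo-part P ⟩
      P                                                    ∎
      where open ≡-Reasoning

    length-MD-shape : length (MD shape) ≡ s
    length-MD-shape = trans (length-map _ (upTo (durfee shape))) (trans (length-applyUpTo _ _) durfee-shape)

    hook-shape : ∀ i j → hook shape i j ≡ (shapePart i ∸ suc j) + (shapePart j ∸ suc i) + 1
    hook-shape i j = trans (hook≡ shape↓ shape-selfConjugate i j)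
      (cong₂ (λ x y → (x ∸ suc j) + (y ∸ suc i) + 1) (part-shape i) (part-shape j))

    hook-inside : ∀ {i j} → i < s → j < s → hook shape i j ≡ part P i + part P j + 1
    hook-inside {i} {j} i<s j<s = begin
      hook shape i j                                          ≡⟨ hook-shape i j ⟩
      (shapePart i ∸ suc j) + (shapePart j ∸ suc i) + 1       ≡⟨ cong₂ (λ x y → (x ∸ suc j) + (y ∸ suc i) + 1)
                                                                        (shapePart-< i<s) (shapePart-< j<s) ⟩
      (row i ∸ suc j) + (row j ∸ suc i) + 1                   ≡⟨ cong (_+ 1) (∸-swap-sum (s≤row′ i<s j<s) (s≤row′ j<s i<s)) ⟩
      part P i + part P j + 1                                 ∎
      where
      open ≡-Reasoning
      s≤row′ : ∀ {i j} → i < s → j < s → j < row i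
      s≤row′ i<s j<s = <-≤-trans j<s (s≤row i<s)

    hook-outside : ∀ {i j} → i < s → s ≤ j → j < shapePart i → hook shape i j ≤ part P i
    hook-outside {i} {j} i<s s≤j j<λᵢ = begin
      hook shape i j                                          ≡⟨ hook-shape i j ⟩
      (shapePart i ∸ suc j) + (shapePart j ∸ suc i) + 1       ≡⟨ cong₂ (λ x y → (x ∸ suc j) + (y ∸ suc i) + 1)
                                                                        (shapePart-< i<s) (shapePart-≥ s≤j) ⟩
      (row i ∸ suc j) + (colLen rows j ∸ suc i) + 1           ≤⟨ ∸-sum-≤ j<rowᵢ (<colLen-rows⇐ i<s j<rowᵢ)
                                                                          (≤-trans (colLen-rows≤s j) s≤j) ⟩
      part P i                                                ∎
      where
      open ≤-Reasoning
      j<rowᵢ : j < row i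
      j<rowᵢ = subst (j <_) (shapePart-< i<s) j<λᵢ

    hook-cases : ∀ {i j} → j < part shape i →
                 (i < s × j < s × hook shape i j ≡ part P i + part P j + 1) ⊎ hook shape i j < t
    hook-cases {i} {j} j<λᵢ with i <? s | j <? s
    ... | yes i<s | yes j<s = inj₁ (i<s , j<s , hook-inside i<s j<s)
    ... | yes i<s | no j≮s  = inj₂ (≤-<-trans (hook-outside i<s (≮⇒≥ j≮s) (subst (j <_) (part-shape i) j<λᵢ))
                                              (bounded i i<s))
    ... | no i≮s  | yes j<s = inj₂ (≤-<-trans (≤-reflexive (hook-symmetric i j))
                                    (≤-<-trans (hook-outside j<s (≮⇒≥ i≮s) (shapePart-selfConjugate i j (subst (j <_) (part-shape i) j<λᵢ)))
                                               (bounded j j<s)))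
      where
      hook-symmetric : ∀ i j → hook shape i j ≡ hook shape j i
      hook-symmetric i j = trans (hook-shape i j) (trans (cong (_+ 1) (+-comm (shapePart i ∸ suc j) _)) (sym (hook-shape j i)))
    ... | no i≮s  | no j≮s  = ⊥-elim (<⇒≱ (subst (j <_) (part-shape i) j<λᵢ)
                                          (subst (_≤ j) (sym (shapePart-≥ (≮⇒≥ i≮s))) (≤-trans (colLen-rows≤s i) (≮⇒≥ j≮s))))

    shape-isCore : ∀ c → t ≤ c → (∀ i j → i < s → j < s → part P i + part P j + 1 ≢ c) → IsCore c shape
    shape-isCore c t≤c avoids-c i j j<λᵢ c∣h with hook-cases j<λᵢ
    ... | inj₂ h<t = <⇒≱ (<-≤-trans h<t t≤c) (∣⇒≤ c∣h)
      where
      instance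
        hook≢0 : NonZero (hook shape i j)
        hook≢0 = >-nonZero (hook>0 shape i j)
    ... | inj₁ (i<s , j<s , h≡) = avoids-c i j i<s j<s (trans (sym h≡) (multiple-below-double c∣h (hook>0 shape i j) (begin-strict
        hook shape i j                  ≡⟨ h≡ ⟩
        part P i + part P j + 1         ≡⟨ +-comm (part P i + part P j) 1 ⟩
        suc (part P i + part P j)       <⟨ +-mono-≤-< (bounded i i<s) (bounded j j<s) ⟩
        t + t                           ≤⟨ +-mono-≤ t≤c t≤c ⟩
        c + c                           ∎)))
      where open ≤-Reasoning

    shape∈DS : DS t shape
    shape∈DS = shape-isPartition , shape-selfConjugate
             , shape-isCore t ≤-refl (λ i j i<s j<s h≡t → hook≢t i j i<s j<s (trans (+-comm 1 _) h≡t))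
             , shape-isCore (suc t) (n≤1+n t) (λ i j i<s j<s h≡1+t → hook≢1+t i j i<s j<s (suc-injective (trans (+-comm 1 _) h≡1+t)))
             , diagonal-distinct


module Extraction where

  open import Data.Nat using (ℕ; zero; suc; _+_; _∸_; _<_; _≤_; _<?_; _≤?_; z≤n; s≤s)
  open import Data.Nat.Properties
  open import Data.Nat.Divisibility using (∣-reflexive)
  open import Data.Nat.Tactic.RingSolver using (solve-∀)
  open import Data.List using (List; length)
  open import Data.List.Relation.Unary.Unique.Propositional using (Unique)
  open import Data.List.Properties using (length-applyUpTo)
  open import Data.Product using (_×_; _,_; proj₁; proj₂; ∃-syntax)
  open import Data.Sum using (inj₁; inj₂)
  open import Data.Empty using (⊥; ⊥-elim)
  open import Function using (_∘_)
  open import Relation.Nullary using (¬_; yes; no)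
  open import Relation.Unary using (Pred; Decidable)
  open import Level using (0ℓ)
  open import Relation.Binary.PropositionalEquality
  open import Defs
  open Partitions
  open ArmSequences

  last-failure : ∀ {Q : Pred ℕ 0ℓ} → Decidable Q → ¬ Q 0 → ∀ {n} → Q n → ∃[ k ] k < n × ¬ Q k × Q (suc k)
  last-failure Q? ¬Q0 {zero}  Q0 = ⊥-elim (¬Q0 Q0)
  last-failure Q? ¬Q0 {suc n} Qn+1 with Q? n
  ... | yes Qn  = let k , k<n , ¬Qk , Qk+1 = last-failure Q? ¬Q0 Qn in k , <-trans k<n (n<1+n n) , ¬Qk , Qk+1
  ... | no  ¬Qn = n , n<1+n n , ¬Qn , Qn+1

  colLen-zero : ∀ {xs} → AllPositive xs → colLen xs 0 ≡ length xs
  colLen-zero ap-[]               = refl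
  colLen-zero (ap-∷ (s≤s z≤n) xs>0) = cong suc (colLen-zero xs>0)

  module _ {t} (t≥1 : 1 ≤ t) {λ′ : List ℕ} (λ′∈DS : DS t λ′) where

    private
      L : ℕ → ℕ
      L = part λ′

      λ′↓ : NonIncreasing λ′
      λ′↓ = proj₁ (proj₁ λ′∈DS)

      λ′>0 : AllPositive λ′
      λ′>0 = proj₂ (proj₁ λ′∈DS)

      λ′-selfConjugate : SelfConjugate λ′
      λ′-selfConjugate = proj₁ (proj₂ λ′∈DS)

      s : ℕ
      s = durfee λ′

      <s⇒on-diagonal : ∀ {k} → k < s → k < L k
      <s⇒on-diagonal = <durfee⇒<part λ′↓

      on-diagonal⇒<s : ∀ {k} → k < L k → k < s
      on-diagonal⇒<s = <part⇒<durfee λ′↓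

      Lₛ≤s : L s ≤ s
      Lₛ≤s with s <? L s
      ... | yes s<Lₛ = ⊥-elim (<-irrefl refl (on-diagonal⇒<s s<Lₛ))
      ... | no  s≮Lₛ = ≮⇒≥ s≮Lₛ

      diagonal-distinct : ∀ {i j} → i < j → j < s → L i ≢ L j
      diagonal-distinct = Unique-applyUpTo⁻ L s
        (subst Unique (take-applyUpTo-part λ′ (durfee≤length λ′)) (proj₂ (proj₂ (proj₂ (proj₂ λ′∈DS)))))

      colLen≡L : ∀ j → colLen λ′ j ≡ L j
      colLen≡L = colLen≡part λ′↓ λ′-selfConjugate

      hook≢t : ∀ {i j} → j < L i → hook λ′ i j ≢ t
      hook≢t {i} {j} j<Lᵢ h≡t = proj₁ (proj₂ (proj₂ λ′∈DS)) i j j<Lᵢ (∣-reflexive (sym h≡t))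

      hook≢1+t : ∀ {i j} → j < L i → hook λ′ i j ≢ suc t
      hook≢1+t {i} {j} j<Lᵢ h≡1+t = proj₁ (proj₂ (proj₂ (proj₂ λ′∈DS))) i j j<Lᵢ (∣-reflexive (sym h≡1+t))

      hook≤1+t⇒<t : ∀ {i j} → j < L i → hook λ′ i j ≤ suc t → hook λ′ i j < t
      hook≤1+t⇒<t j<Lᵢ h≤1+t with m≤n⇒m<n∨m≡n h≤1+t
      ... | inj₂ h≡1+t = ⊥-elim (hook≢1+t j<Lᵢ h≡1+t)
      ... | inj₁ h≤t with m≤n⇒m<n∨m≡n (≤-pred h≤t)
      ...   | inj₁ h<t = h<t
      ...   | inj₂ h≡t = ⊥-elim (hook≢t j<Lᵢ h≡t)

      length≡L0 : length λ′ ≡ L 0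
      length≡L0 = trans (sym (colLen-zero λ′>0)) (colLen≡L 0)

      hook-first-row : ∀ {j} → j < L 0 → hook λ′ 0 j + suc j ≡ L 0 + L j
      hook-first-row {j} j<L0 = begin
        hook λ′ 0 j + suc j                          ≡⟨ cong (_+ suc j) (hook≡ λ′↓ λ′-selfConjugate 0 j) ⟩
        (L 0 ∸ suc j) + (L j ∸ 1) + 1 + suc j        ≡⟨ shuffle (L 0 ∸ suc j) (L j ∸ 1) j ⟩
        ((L 0 ∸ suc j) + suc j) + ((L j ∸ 1) + 1)    ≡⟨ cong₂ _+_ (m∸n+n≡m j<L0) (m∸n+n≡m Lj>0) ⟩
        L 0 + L j                                    ∎
        where
        open ≡-Reasoning
        shuffle : ∀ u v j → u + v + 1 + suc j ≡ (u + suc j) + (v + 1)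
        shuffle = solve-∀
        Lj>0 : 0 < L j
        Lj>0 = <length⇒part>0 λ′>0 (subst (j <_) (sym length≡L0) j<L0)

      -- If λ₁ > t, the first-row hook lengths λ₁ + λⱼ₊₁ - j - 1 start above t + 1; at the first column
      -- where they drop to at most t + 1 they must in fact be below t, and then two consecutive columns
      -- b, b + 1 have the same length, which self-conjugacy turns into two equal diagonal parts.
      module LongFirstRow (t<L0 : t < L 0) where

        m : ℕ
        m = L 0

        Q : Pred ℕ 0ℓ
        Q j = L j + m ≤ suc (suc (t + j))

        ¬Q0 : ¬ Q 0
        ¬Q0 Q0 = <⇒≱ (begin-strict
          suc (suc (t + 0))           <⟨ m<m+n (suc (suc (t + 0))) t≥1 ⟩
          suc (suc (t + 0)) + t       ≡⟨ shuffle t ⟩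
          suc t + suc t               ≤⟨ +-mono-≤ t<L0 t<L0 ⟩
          m + m                       ∎) Q0
          where
          open ≤-Reasoning
          shuffle : ∀ t → suc (suc (t + 0)) + t ≡ suc t + suc t
          shuffle = solve-∀

        Qm : Q m
        Qm = begin
          L m + m     ≡⟨ cong (_+ m) (part-≥length λ′ (≤-reflexive length≡L0)) ⟩
          m           ≤⟨ m≤n+m m (suc (suc t)) ⟩
          suc (suc (t + m)) ∎
          where open ≤-Reasoning

        crossing : ∃[ k ] k < m × ¬ Q k × Q (suc k)
        crossing = last-failure (λ j → L j + m ≤? suc (suc (t + j))) ¬Q0 Qm

        k b : ℕ
        k = proj₁ crossing
        b = L (suc k)

        k<m : k < m
        k<m = proj₁ (proj₂ crossing)

        ¬Qk : ¬ Q k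
        ¬Qk = proj₁ (proj₂ (proj₂ crossing))

        Qk+1 : Q (suc k)
        Qk+1 = proj₂ (proj₂ (proj₂ crossing))

        b+m≤ : b + m ≤ t + suc k
        b+m≤ with suc k <? m
        ... | yes 1+k<m = begin
            b + m                     ≡⟨ +-comm b m ⟩
            m + b                     ≡⟨ hook-first-row 1+k<m ⟨
            h + suc (suc k)           ≡⟨ +-suc h (suc k) ⟩
            suc h + suc k             ≤⟨ +-monoˡ-≤ (suc k) (hook≤1+t⇒<t 1+k<m h≤1+t) ⟩
            t + suc k                 ∎
          where
          open ≤-Reasoning
          h : ℕ
          h = hook λ′ 0 (suc k)
          h≤1+t : h ≤ suc t
          h≤1+t = +-cancelʳ-≤ (suc (suc k)) h (suc t) (begin
            h + suc (suc k)           ≡⟨ trans (hook-first-row 1+k<m) (+-comm m b) ⟩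
            b + m                     ≤⟨ Qk+1 ⟩
            suc (suc (t + suc k))     ≡⟨ cong suc (sym (+-suc t (suc k))) ⟩
            suc t + suc (suc k)       ∎)
        ... | no 1+k≮m = begin
            b + m                     ≡⟨ cong (_+ m) (part-≥length λ′ (subst (_≤ suc k) (sym length≡L0) (≮⇒≥ 1+k≮m))) ⟩
            m                         ≡⟨ ≤-antisym k<m (≮⇒≥ 1+k≮m) ⟨
            suc k                     ≤⟨ m≤n+m (suc k) t ⟩
            t + suc k                 ∎
          where open ≤-Reasoning

        b≤k : b ≤ k
        b≤k = ≤-pred (+-cancelʳ-≤ t (suc b) (suc k) (begin
          suc b + t                   ≡⟨ +-suc b t ⟨
          b + suc t                   ≤⟨ +-monoʳ-≤ b t<L0 ⟩
          b + m                       ≤⟨ b+m≤ ⟩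
          t + suc k                   ≡⟨ +-comm t (suc k) ⟩
          suc k + t                   ∎))
          where open ≤-Reasoning

        b+2≤Lk : b + 2 ≤ L k
        b+2≤Lk = +-cancelʳ-≤ m (b + 2) (L k) (begin
          b + 2 + m                   ≡⟨ shuffle b m ⟩
          b + m + 2                   ≤⟨ +-monoˡ-≤ 2 b+m≤ ⟩
          t + suc k + 2               ≡⟨ shuffle′ t k ⟩
          suc (suc (suc (t + k)))     ≤⟨ ≰⇒> ¬Qk ⟩
          L k + m                     ∎)
          where
          open ≤-Reasoning
          shuffle : ∀ b m → b + 2 + m ≡ b + m + 2
          shuffle = solve-∀
          shuffle′ : ∀ t k → t + suc k + 2 ≡ suc (suc (suc (t + k)))
          shuffle′ = solve-∀

        column-length : ∀ {c} → b ≤ c → c < L k → L c ≡ suc k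
        column-length {c} b≤c c<Lk = trans (sym (colLen≡L c)) (<-extensional
          (λ {r} r<col → row-above (<colLen⇒<part λ′↓ r<col))
          (λ {r} r≤k → <part⇒<colLen λ′↓ (<-≤-trans c<Lk (part-antitone λ′↓ (≤-pred r≤k)))))
          where
          row-above : ∀ {r} → c < L r → r < suc k
          row-above {r} c<Lr with r <? suc k
          ... | yes r≤k = r≤k
          ... | no  r≰k = ⊥-elim (<⇒≱ c<Lr (≤-trans (part-antitone λ′↓ (≮⇒≥ r≰k)) b≤c))

        1+b<Lk : suc b < L k
        1+b<Lk = subst (_≤ L k) (+-comm b 2) b+2≤Lk

        Lb≡1+k : L b ≡ suc k
        Lb≡1+k = column-length ≤-refl (<-trans (n<1+n b) 1+b<Lk)

        L1+b≡1+k : L (suc b) ≡ suc k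
        L1+b≡1+k = column-length (n≤1+n b) 1+b<Lk

        absurd : ⊥
        absurd with m≤n⇒m<n∨m≡n b≤k
        ... | inj₁ b<k = diagonal-distinct (n<1+n b) (on-diagonal⇒<s (subst (suc b <_) (sym L1+b≡1+k) (s≤s b<k)))
                           (trans Lb≡1+k (sym L1+b≡1+k))
        ... | inj₂ b≡k = <-irrefl refl (subst (suc b <_) (trans (cong L (sym b≡k)) (trans Lb≡1+k (cong suc (sym b≡k)))) 1+b<Lk)

      L0≤t : L 0 ≤ t
      L0≤t with L 0 ≤? t
      ... | yes L0≤t = L0≤t
      ... | no  L0≰t = ⊥-elim (LongFirstRow.absurd (≰⇒> L0≰t))

      P : List ℕ
      P = arms λ′

      length-P : length P ≡ s
      length-P = length-applyUpTo _ s

      <length-P : ∀ {i} → i < length P → i < s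
      <length-P {i} = subst (i <_) length-P

      part-P : ∀ {i} → i < s → part P i + suc i ≡ L i
      part-P i<s = trans (cong (_+ _) (part-applyUpTo _ s i<s)) (m∸n+n≡m (<s⇒on-diagonal i<s))

      square-box : ∀ {i j} → i < s → j < s → j < L i
      square-box {i} {j} i<s j<s with i ≤? j
      ... | yes i≤j = <-≤-trans (<s⇒on-diagonal j<s) (part-antitone λ′↓ i≤j)
      ... | no  i≰j = <-trans (≰⇒> i≰j) (<s⇒on-diagonal i<s)

      hook-square : ∀ {i j} → i < s → j < s → hook λ′ i j ≡ suc (part P i + part P j)
      hook-square {i} {j} i<s j<s = begin
        hook λ′ i j                                                   ≡⟨ hook≡ λ′↓ λ′-selfConjugate i j ⟩
        (L i ∸ suc j) + (L j ∸ suc i) + 1                             ≡⟨ cong₂ (λ x y → (x ∸ suc j) + (y ∸ suc i) + 1)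
                                                                                (part-P i<s) (part-P j<s) ⟨
        (part P i + suc i ∸ suc j) + (part P j + suc j ∸ suc i) + 1   ≡⟨ cong (_+ 1) (∸-swap-sum (in-row i<s j<s) (in-row j<s i<s)) ⟩
        part P i + part P j + 1                                       ≡⟨ +-comm _ 1 ⟩
        suc (part P i + part P j)                                     ∎
        where
        open ≡-Reasoning
        in-row : ∀ {i j} → i < s → j < s → j < part P i + suc i
        in-row i<s j<s = subst (_ <_) (sym (part-P i<s)) (square-box i<s j<s)

    arms-admissible : Admissible t (arms λ′)
    arms-admissible = record { gap = gap ; bounded = bounded ; hook≢t = square-hook≢t ; hook≢1+t = square-hook≢1+t }
      where
      gap : Gapped P
      gap i 1+i<n = +-cancelʳ-≤ (suc i) _ _ (begin
        part P (suc i) + 2 + suc i        ≡⟨ shuffle (part P (suc i)) i ⟩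
        suc (part P (suc i) + suc (suc i)) ≡⟨ cong suc (part-P 1+i<s) ⟩
        suc (L (suc i))                   ≤⟨ ≤∧≢⇒< (part-antitone λ′↓ (n≤1+n i)) (diagonal-distinct (n<1+n i) 1+i<s ∘ sym) ⟩
        L i                               ≡⟨ part-P (<-trans (n<1+n i) 1+i<s) ⟨
        part P i + suc i                  ∎)
        where
        open ≤-Reasoning
        1+i<s : suc i < s
        1+i<s = <length-P 1+i<n
        shuffle : ∀ x i → x + 2 + suc i ≡ suc (x + suc (suc i))
        shuffle = solve-∀
      bounded : ∀ i → i < length P → part P i < t
      bounded i i<n = <-≤-trans (m<m+n (part P i) (s≤s z≤n))
        (≤-trans (≤-reflexive (part-P (<length-P i<n))) (≤-trans (part-antitone λ′↓ z≤n) L0≤t))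
      square-hook≢t : ∀ i j → i < length P → j < length P → suc (part P i + part P j) ≢ t
      square-hook≢t i j i<n j<n = hook≢t (square-box (<length-P i<n) (<length-P j<n))
                                ∘ trans (hook-square (<length-P i<n) (<length-P j<n))
      square-hook≢1+t : ∀ i j → i < length P → j < length P → part P i + part P j ≢ t
      square-hook≢1+t i j i<n j<n = hook≢1+t (square-box (<length-P i<n) (<length-P j<n))
                                  ∘ trans (hook-square (<length-P i<n) (<length-P j<n)) ∘ cong suc

    fromArms-arms : fromArms (arms λ′) ≡ λ′
    fromArms-arms = part-injective (proj₂ shape-isPartition) λ′>0 (λ i → trans (part-shape i) (shapePart≡L i))
      where
      open FromAdmissible arms-admissible using (shape-isPartition; part-shape; shapePart; shapePart-<; shapePart-≥; rows; <colLen-rows⇒; <colLen-rows⇐)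
      shapePart≡L : ∀ i → shapePart i ≡ L i
      shapePart≡L i with i <? s
      ... | yes i<s = trans (shapePart-< (subst (i <_) (sym length-P) i<s)) (part-P i<s)
      ... | no  i≮s = trans (shapePart-≥ (subst (_≤ i) (sym length-P) (≮⇒≥ i≮s)))
                            (trans (<-extensional below-column column-below) (colLen≡L i))
        where
        below-column : ∀ {k} → k < colLen rows i → k < colLen λ′ i
        below-column k<c with <colLen-rows⇒ k<c
        ... | k<n , i<rowₖ = <part⇒<colLen λ′↓ (subst (i <_) (part-P (<length-P k<n)) i<rowₖ)
        column-below : ∀ {k} → k < colLen λ′ i → k < colLen rows i
        column-below {k} k<c = <colLen-rows⇐ (subst (k <_) (sym length-P) k<s)
                                             (subst (i <_) (sym (part-P k<s)) i<Lₖ)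
          where
          i<Lₖ : i < L k
          i<Lₖ = <colLen⇒<part λ′↓ k<c
          k<s : k < s
          k<s with k <? s
          ... | yes k<s = k<s
          ... | no  k≮s = ⊥-elim (<⇒≱ i<Lₖ (≤-trans (part-antitone λ′↓ (≮⇒≥ k≮s)) (≤-trans Lₛ≤s (≮⇒≥ i≮s))))


module ShapeSize where

  open import Data.Nat using (ℕ; zero; suc; _+_; _*_; _∸_; _<_; _<ᵇ_; _≤_; _⊓_; z≤n)
  open import Data.Nat.Properties
  open import Data.Nat.ListAction using (sum)
  open import Data.Nat.ListAction.Properties using (sum-++)
  open import Data.Nat.Tactic.RingSolver using (solve-∀)
  open import Data.List using (List; []; _∷_; _∷ʳ_; length; map; applyUpTo)
  open import Data.List.Properties using (applyUpTo-∷ʳ; map-applyUpTo)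
  open import Data.Bool using (true; false)
  open import Relation.Nullary.Reflects using (ofʸ; ofⁿ)
  open import Relation.Binary.PropositionalEquality
  open import Algebra.Properties.CommutativeSemigroup +-commutativeSemigroup using (interchange; xy∙z≈xz∙y)
  open import Defs
  open Partitions
  open ArmSequences

  sumUpTo : (ℕ → ℕ) → ℕ → ℕ
  sumUpTo f n = sum (applyUpTo f n)

  sumUpTo-suc : ∀ f n → sumUpTo f (suc n) ≡ sumUpTo f n + f n
  sumUpTo-suc f n = begin
    sum (applyUpTo f (suc n))         ≡⟨ cong sum (applyUpTo-∷ʳ f n) ⟨
    sum (applyUpTo f n ∷ʳ f n)        ≡⟨ sum-++ (applyUpTo f n) (f n ∷ []) ⟩
    sumUpTo f n + (f n + 0)           ≡⟨ cong (sumUpTo f n +_) (+-identityʳ (f n)) ⟩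
    sumUpTo f n + f n                 ∎
    where open ≡-Reasoning

  sumUpTo-cong : ∀ {f g} n → (∀ {i} → i < n → f i ≡ g i) → sumUpTo f n ≡ sumUpTo g n
  sumUpTo-cong n f≗g = cong sum (applyUpTo-cong n f≗g)

  sumUpTo-+ : ∀ f g n → sumUpTo (λ i → f i + g i) n ≡ sumUpTo f n + sumUpTo g n
  sumUpTo-+ f g zero    = refl
  sumUpTo-+ f g (suc n) = begin
    sumUpTo (λ i → f i + g i) (suc n)             ≡⟨ sumUpTo-suc _ n ⟩
    sumUpTo (λ i → f i + g i) n + (f n + g n)     ≡⟨ cong (_+ (f n + g n)) (sumUpTo-+ f g n) ⟩
    sumUpTo f n + sumUpTo g n + (f n + g n)       ≡⟨ interchange (sumUpTo f n) (sumUpTo g n) (f n) (g n) ⟩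
    (sumUpTo f n + f n) + (sumUpTo g n + g n)     ≡⟨ cong₂ _+_ (sumUpTo-suc f n) (sumUpTo-suc g n) ⟨
    sumUpTo f (suc n) + sumUpTo g (suc n)         ∎
    where open ≡-Reasoning

  sumUpTo-const : ∀ c n → sumUpTo (λ _ → c) n ≡ n * c
  sumUpTo-const c zero    = refl
  sumUpTo-const c (suc n) = trans (sumUpTo-suc _ n) (trans (cong (_+ c) (sumUpTo-const c n)) (+-comm (n * c) c))

  2*sumUpTo-suc : ∀ n → 2 * sumUpTo suc n ≡ n * n + n
  2*sumUpTo-suc zero    = refl
  2*sumUpTo-suc (suc n) = begin
    2 * sumUpTo suc (suc n)            ≡⟨ cong (2 *_) (sumUpTo-suc suc n) ⟩
    2 * (sumUpTo suc n + suc n)        ≡⟨ *-distribˡ-+ 2 (sumUpTo suc n) (suc n) ⟩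
    2 * sumUpTo suc n + 2 * suc n      ≡⟨ cong (_+ 2 * suc n) (2*sumUpTo-suc n) ⟩
    n * n + n + 2 * suc n              ≡⟨ gauss n ⟩
    suc n * suc n + suc n              ∎
    where
    open ≡-Reasoning
    gauss : ∀ n → n * n + n + 2 * suc n ≡ suc n * suc n + suc n
    gauss = solve-∀

  -- Both sides add the sum of g below s, so that no subtraction is needed.
  sumUpTo-piecewise : ∀ {h f g} s d → (∀ {i} → i < s → h i ≡ f i) → (∀ {i} → s ≤ i → h i ≡ g i) →
                      sumUpTo h (s + d) + sumUpTo g s ≡ sumUpTo f s + sumUpTo g (s + d)
  sumUpTo-piecewise {h} {f} {g} s zero h≡f _ = begin
    sumUpTo h (s + 0) + sumUpTo g s    ≡⟨ cong (λ n → sumUpTo h n + sumUpTo g s) (+-identityʳ s) ⟩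
    sumUpTo h s + sumUpTo g s          ≡⟨ cong (_+ sumUpTo g s) (sumUpTo-cong s h≡f) ⟩
    sumUpTo f s + sumUpTo g s          ≡⟨ cong (λ n → sumUpTo f s + sumUpTo g n) (+-identityʳ s) ⟨
    sumUpTo f s + sumUpTo g (s + 0)    ∎
    where open ≡-Reasoning
  sumUpTo-piecewise {h} {f} {g} s (suc d) h≡f h≡g = begin
    sumUpTo h (s + suc d) + sumUpTo g s              ≡⟨ cong (λ n → sumUpTo h n + sumUpTo g s) (+-suc s d) ⟩
    sumUpTo h (suc (s + d)) + sumUpTo g s            ≡⟨ cong (_+ sumUpTo g s) (sumUpTo-suc h (s + d)) ⟩
    sumUpTo h (s + d) + h (s + d) + sumUpTo g s      ≡⟨ xy∙z≈xz∙y (sumUpTo h (s + d)) (h (s + d)) (sumUpTo g s) ⟩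
    sumUpTo h (s + d) + sumUpTo g s + h (s + d)      ≡⟨ cong₂ _+_ (sumUpTo-piecewise s d h≡f h≡g) (h≡g (m≤m+n s d)) ⟩
    sumUpTo f s + sumUpTo g (s + d) + g (s + d)      ≡⟨ +-assoc (sumUpTo f s) _ _ ⟩
    sumUpTo f s + (sumUpTo g (s + d) + g (s + d))    ≡⟨ cong (sumUpTo f s +_) (sumUpTo-suc g (s + d)) ⟨
    sumUpTo f s + sumUpTo g (suc (s + d))            ≡⟨ cong (λ n → sumUpTo f s + sumUpTo g n) (+-suc s d) ⟨
    sumUpTo f s + sumUpTo g (s + suc d)              ∎
    where open ≡-Reasoning

  colLen-∷ : ∀ x xs j → colLen (x ∷ xs) j ≡ colLen (x ∷ []) j + colLen xs j
  colLen-∷ x xs j with j <ᵇ x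
  ... | true  = refl
  ... | false = refl

  sumUpTo-colLen-[x] : ∀ x M → sumUpTo (colLen (x ∷ [])) M ≡ x ⊓ M
  sumUpTo-colLen-[x] x zero    = sym (⊓-zeroʳ x)
  sumUpTo-colLen-[x] x (suc M) = trans (sumUpTo-suc _ M) (trans (cong (_+ colLen (x ∷ []) M) (sumUpTo-colLen-[x] x M)) step)
    where
    step : x ⊓ M + colLen (x ∷ []) M ≡ x ⊓ suc M
    step with M <ᵇ x | <ᵇ-reflects-< M x
    ... | true  | ofʸ M<x = trans (cong (_+ 1) (m≥n⇒m⊓n≡n (<⇒≤ M<x))) (trans (+-comm M 1) (sym (m≥n⇒m⊓n≡n M<x)))
    ... | false | ofⁿ M≮x = trans (+-identityʳ _) (trans (m≤n⇒m⊓n≡m (≮⇒≥ M≮x)) (sym (m≤n⇒m⊓n≡m (≤-trans (≮⇒≥ M≮x) (n≤1+n M)))))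

  -- Counting the boxes of the first M columns column by column and row by row.
  sumUpTo-colLen : ∀ xs M → sumUpTo (colLen xs) M ≡ sum (map (_⊓ M) xs)
  sumUpTo-colLen []       M = trans (sumUpTo-const 0 M) (*-zeroʳ M)
  sumUpTo-colLen (x ∷ xs) M = begin
    sumUpTo (colLen (x ∷ xs)) M                            ≡⟨ sumUpTo-cong M (λ {j} _ → colLen-∷ x xs j) ⟩
    sumUpTo (λ j → colLen (x ∷ []) j + colLen xs j) M      ≡⟨ sumUpTo-+ (colLen (x ∷ [])) (colLen xs) M ⟩
    sumUpTo (colLen (x ∷ [])) M + sumUpTo (colLen xs) M    ≡⟨ cong₂ _+_ (sumUpTo-colLen-[x] x M) (sumUpTo-colLen xs M) ⟩
    x ⊓ M + sum (map (_⊓ M) xs)                            ∎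
    where open ≡-Reasoning

  diagonalHook : ℕ → ℕ
  diagonalHook p = suc (p + p)

  diagonalHookSum : List ℕ → ℕ
  diagonalHookSum P = sum (map diagonalHook P)

  diagonalHookSum≡ : ∀ P → diagonalHookSum P ≡ 2 * sum P + length P
  diagonalHookSum≡ []       = refl
  diagonalHookSum≡ (p ∷ P) = trans (cong (suc (p + p) +_) (diagonalHookSum≡ P)) (shuffle p (sum P) (length P))
    where
    shuffle : ∀ x y z → suc (x + x) + (2 * y + z) ≡ 2 * (x + y) + suc z
    shuffle = solve-∀

  module _ {t P} (adm : Admissible t P) where

    open FromAdmissible adm

    private
      c : ℕ → ℕ
      c = colLen rows

      sum-columns : sumUpTo c height ≡ sumUpTo row s
      sum-columns = begin
        sumUpTo c height                            ≡⟨ sumUpTo-colLen rows height ⟩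
        sum (map (_⊓ height) (applyUpTo row s))     ≡⟨ cong sum (map-applyUpTo row (_⊓ height) s) ⟩
        sumUpTo (λ k → row k ⊓ height) s            ≡⟨ sumUpTo-cong s (λ k<s → m≤n⇒m⊓n≡m (row≤height k<s)) ⟩
        sumUpTo row s                               ∎
        where
        open ≡-Reasoning
        row≤height : ∀ {k} → k < s → row k ≤ height
        row≤height k<s = subst (row _ ≤_) (sym (height≡row0 (≤-<-trans z≤n k<s))) (row-antitone z≤n k<s)

      sum-square-columns : sumUpTo c s ≡ s * s
      sum-square-columns = begin
        sumUpTo c s                                 ≡⟨ sumUpTo-colLen rows s ⟩
        sum (map (_⊓ s) (applyUpTo row s))          ≡⟨ cong sum (map-applyUpTo row (_⊓ s) s) ⟩
        sumUpTo (λ k → row k ⊓ s) s                 ≡⟨ sumUpTo-cong s (λ k<s → m≥n⇒m⊓n≡n (s≤row k<s)) ⟩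
        sumUpTo (λ _ → s) s                         ≡⟨ sumUpTo-const s s ⟩
        s * s                                       ∎
        where open ≡-Reasoning

      sum-rows : sumUpTo row s ≡ sum P + sumUpTo suc s
      sum-rows = trans (sumUpTo-+ (part P) suc s) (cong (_+ sumUpTo suc s) (cong sum (applyUpTo-part P)))

    -- The rows below the Durfee square are its columns, so |λ| = 2 (sum of its rows) - s².
    size-fromArms : size (fromArms P) ≡ diagonalHookSum P
    size-fromArms = +-cancelʳ-≡ (s * s) _ _ (begin
      sumUpTo shapePart height + s * s                  ≡⟨ cong (sumUpTo shapePart height +_) sum-square-columns ⟨
      sumUpTo shapePart height + sumUpTo c s            ≡⟨ cong (λ n → sumUpTo shapePart n + sumUpTo c s) (m+[n∸m]≡n s≤height) ⟨
      sumUpTo shapePart (s + (height ∸ s)) + sumUpTo c s ≡⟨ sumUpTo-piecewise s (height ∸ s) shapePart-< shapePart-≥ ⟩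
      sumUpTo row s + sumUpTo c (s + (height ∸ s))      ≡⟨ cong (λ n → sumUpTo row s + sumUpTo c n) (m+[n∸m]≡n s≤height) ⟩
      sumUpTo row s + sumUpTo c height                  ≡⟨ cong (sumUpTo row s +_) sum-columns ⟩
      sumUpTo row s + sumUpTo row s                     ≡⟨ cong₂ _+_ sum-rows sum-rows ⟩
      (sum P + sumUpTo suc s) + (sum P + sumUpTo suc s) ≡⟨ double (sum P) (sumUpTo suc s) ⟩
      2 * sum P + 2 * sumUpTo suc s                     ≡⟨ cong (2 * sum P +_) (2*sumUpTo-suc s) ⟩
      2 * sum P + (s * s + s)                           ≡⟨ shuffle (sum P) s ⟩
      (2 * sum P + s) + s * s                           ≡⟨ cong (_+ s * s) (diagonalHookSum≡ P) ⟨
      diagonalHookSum P + s * s                         ∎)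
      where
      open ≡-Reasoning
      double : ∀ x y → (x + y) + (x + y) ≡ 2 * x + 2 * y
      double = solve-∀
      shuffle : ∀ x s → 2 * x + (s * s + s) ≡ (2 * x + s) + s * s
      shuffle = solve-∀


module Enumeration where

  open import Data.Nat using (ℕ; zero; suc; _+_; _*_; _∸_; _<_; _≤_; _<?_; _≟_; z≤n; s≤s)
  open import Data.Nat.Properties
  open import Data.Nat.Tactic.RingSolver using (solve-∀)
  open import Data.List using (List; []; _∷_; length; map; applyUpTo; applyDownFrom; reverse; _∷ʳ_; _++_)
  open import Data.List.Properties using (applyUpTo-∷ʳ; length-applyUpTo; length-map; length-++; ∷ʳ-injective; map-applyUpTo; reverse-applyUpTo; map-∘; map-++; map-cong)
  open import Data.Product using (_×_; _,_; proj₁; ∃-syntax)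
  open import Data.Sum using (_⊎_; inj₁; inj₂; [_,_]′)
  open import Data.Empty using (⊥-elim)
  open import Relation.Nullary using (¬_; yes; no)
  open import Relation.Binary.PropositionalEquality
  open import Function using (_∘_)
  open import Data.List.Membership.Propositional using (_∈_)
  open import Data.List.Membership.Propositional.Properties using (∈-map⁺; ∈-map⁻; ∈-++⁺ˡ; ∈-++⁺ʳ; ∈-++⁻)
  open import Data.List.Relation.Unary.Any using (here; there)
  open import Data.List.Relation.Unary.All as All using ([]; _∷_)
  import Data.List.Relation.Unary.All.Properties as All
  open import Data.List.Relation.Unary.AllPairs using ([]; _∷_)
  open import Data.List.Relation.Unary.Unique.Propositional using (Unique)
  open import Data.List.Relation.Unary.Unique.Propositional.Properties using (++⁺)
  open import Algebra.Properties.CommutativeSemigroup +-commutativeSemigroup using (interchange)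
  open import Data.Nat.ListAction using (sum)
  open import Data.Nat.ListAction.Properties using (sum-++; sum-↭)
  open import Data.List.Relation.Binary.Permutation.Propositional.Properties using (↭-reverse) renaming (map⁺ to ↭-map⁺)
  open import Defs
  open Partitions
  open ArmSequences
  open ShapeSize using (diagonalHook; diagonalHookSum)

  mirror : ℕ → ℕ → ℕ
  mirror n i = n ∸ suc i

  mirror-< : ∀ {n i} → i < n → mirror n i < n
  mirror-< {suc n} {i} _ = s≤s (m∸n≤m n i)

  mirror-involutive : ∀ {n i} → i < n → mirror n (mirror n i) ≡ i
  mirror-involutive {suc n} (s≤s i≤n) = m∸[m∸n]≡n i≤n

  mirror-suc : ∀ {n i} → suc i < n → suc (mirror n (suc i)) ≡ mirror n i
  mirror-suc {suc n} (s≤s 1+i≤n) = sym (+-∸-assoc 1 1+i≤n)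

  BoundedBy : ℕ → List ℕ → Set
  BoundedBy c L = ∀ i → i < length L → part L i ≤ c

  applyDownFrom-mirror : ∀ (f : ℕ → ℕ) n → applyDownFrom f n ≡ applyUpTo (f ∘ mirror n) n
  applyDownFrom-mirror f zero    = refl
  applyDownFrom-mirror f (suc n) = cong (f n ∷_) (applyDownFrom-mirror f n)

  reflect : ℕ → List ℕ → List ℕ
  reflect c L = reverse (map (c ∸_) L)

  module _ (c : ℕ) (L : List ℕ) where

    private
      n : ℕ
      n = length L

    reflect-applyUpTo : reflect c L ≡ applyUpTo (λ i → c ∸ part L (mirror n i)) n
    reflect-applyUpTo = begin
      reverse (map (c ∸_) L)                            ≡⟨ cong (reverse ∘ map (c ∸_)) (applyUpTo-part L) ⟨
      reverse (map (c ∸_) (applyUpTo (part L) n))       ≡⟨ cong reverse (map-applyUpTo (part L) (c ∸_) n) ⟩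
      reverse (applyUpTo (λ i → c ∸ part L i) n)        ≡⟨ reverse-applyUpTo _ n ⟩
      applyDownFrom (λ i → c ∸ part L i) n              ≡⟨ applyDownFrom-mirror _ n ⟩
      applyUpTo (λ i → c ∸ part L (mirror n i)) n       ∎
      where open ≡-Reasoning

    length-reflect : length (reflect c L) ≡ n
    length-reflect = trans (cong length reflect-applyUpTo) (length-applyUpTo _ n)

    part-reflect : ∀ {i} → i < n → part (reflect c L) i ≡ c ∸ part L (mirror n i)
    part-reflect i<n = trans (cong (λ M → part M _) reflect-applyUpTo) (part-applyUpTo _ n i<n)

    reflect-boundedBy : BoundedBy c (reflect c L)
    reflect-boundedBy i i<n′ = subst (_≤ c) (sym (part-reflect (subst (i <_) length-reflect i<n′))) (m∸n≤m c (part L (mirror n i)))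

    module _ (L≤c : BoundedBy c L) where

      part-reflect+part : ∀ {i} → i < n → part (reflect c L) i + part L (mirror n i) ≡ c
      part-reflect+part {i} i<n = trans (cong (_+ part L (mirror n i)) (part-reflect i<n)) (m∸n+n≡m (L≤c _ (mirror-< i<n)))

      part-reflect+≤ : ∀ {i b} → i < n → b ≤ part L (mirror n i) → part (reflect c L) i + b ≤ c
      part-reflect+≤ {i} i<n b≤ = ≤-trans (+-monoʳ-≤ (part (reflect c L) i) b≤) (≤-reflexive (part-reflect+part i<n))

      pair-sum-reflect : ∀ {i j} → i < n → j < n →
        (part (reflect c L) i + part (reflect c L) j) + (part L (mirror n i) + part L (mirror n j)) ≡ c + c
      pair-sum-reflect {i} {j} i<n j<n =
        trans (interchange (part (reflect c L) i) (part (reflect c L) j) (part L (mirror n i)) (part L (mirror n j))) (cong₂ _+_ (part-reflect+part i<n) (part-reflect+part j<n))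

      reflect-gapped : Gapped L → Gapped (reflect c L)
      reflect-gapped L-gapped i 1+i<n′ = +-cancelʳ-≤ (ℓ (suc i) + ℓ i) _ _ (begin
        M (suc i) + 2 + (ℓ (suc i) + ℓ i)   ≡⟨ shuffle (M (suc i)) (ℓ (suc i)) (ℓ i) ⟩
        (M (suc i) + ℓ (suc i)) + (ℓ i + 2) ≡⟨ cong (_+ (ℓ i + 2)) (part-reflect+part 1+i<n) ⟩
        c + (ℓ i + 2)                       ≤⟨ +-monoʳ-≤ c (subst (λ k → part L k + 2 ≤ ℓ (suc i)) (mirror-suc 1+i<n)
                                                                  (L-gapped (mirror n (suc i)) 1+i′<n)) ⟩
        c + ℓ (suc i)                       ≡⟨ cong (_+ ℓ (suc i)) (part-reflect+part i<n) ⟨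
        (M i + ℓ i) + ℓ (suc i)             ≡⟨ shuffle′ (M i) (ℓ i) (ℓ (suc i)) ⟩
        M i + (ℓ (suc i) + ℓ i)             ∎)
        where
        open ≤-Reasoning
        M ℓ : ℕ → ℕ
        M = part (reflect c L)
        ℓ i = part L (mirror n i)
        1+i<n : suc i < n
        1+i<n = subst (suc i <_) length-reflect 1+i<n′
        i<n : i < n
        i<n = <-trans (n<1+n i) 1+i<n
        1+i′<n : suc (mirror n (suc i)) < n
        1+i′<n = subst (_< n) (sym (mirror-suc 1+i<n)) (mirror-< i<n)
        shuffle : ∀ a b d → a + 2 + (b + d) ≡ (a + b) + (d + 2)
        shuffle = solve-∀
        shuffle′ : ∀ a b d → (a + b) + d ≡ a + (d + b)
        shuffle′ = solve-∀

      mirror-pair-sum : ∀ {i j b} → i < n → j < n → part (reflect c L) i + part (reflect c L) j + b ≡ c + c →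
                        part L (mirror n i) + part L (mirror n j) ≡ b
      mirror-pair-sum i<n j<n eq = +-cancelˡ-≡ _ _ _ (trans (pair-sum-reflect i<n j<n) (sym eq))

      mirror-pair-sum-suc : ∀ {i j b} → i < n → j < n → part (reflect c L) i + part (reflect c L) j + b ≡ suc (c + c) →
                            suc (part L (mirror n i) + part L (mirror n j)) ≡ b
      mirror-pair-sum-suc i<n j<n eq =
        +-cancelˡ-≡ _ _ _ (trans (+-suc _ _) (trans (cong suc (pair-sum-reflect i<n j<n)) (sym eq)))

  reflect-involutive : ∀ c L → BoundedBy c L → reflect c (reflect c L) ≡ L
  reflect-involutive c L L≤c = part-extensional (trans (length-reflect c M) (length-reflect c L)) λ {i} i<n″ →
    let i<n = subst (i <_) (trans (length-reflect c M) (length-reflect c L)) i<n″ in begin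
    part (reflect c M) i                         ≡⟨ part-reflect c M (subst (i <_) (length-reflect c M) i<n″) ⟩
    c ∸ part M (mirror (length M) i)             ≡⟨ cong (λ m → c ∸ part M (mirror m i)) (length-reflect c L) ⟩
    c ∸ part M (mirror n i)                      ≡⟨ cong (c ∸_) (part-reflect c L (mirror-< i<n)) ⟩
    c ∸ (c ∸ part L (mirror n (mirror n i)))     ≡⟨ cong (λ k → c ∸ (c ∸ part L k)) (mirror-involutive i<n) ⟩
    c ∸ (c ∸ part L i)                           ≡⟨ m∸[m∸n]≡n (L≤c i i<n) ⟩
    part L i                                     ∎
    where
    open ≡-Reasoning
    M : List ℕ
    M = reflect c L
    n : ℕ
    n = length L

  admissible-boundedBy : ∀ {t P} → Admissible t P → BoundedBy t P
  admissible-boundedBy adm i i<n = <⇒≤ (Admissible.bounded adm i i<n)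

  appendZero : List ℕ → List ℕ
  appendZero L = L ∷ʳ 0

  length-appendZero : ∀ L → length (appendZero L) ≡ suc (length L)
  length-appendZero []      = refl
  length-appendZero (_ ∷ L) = cong suc (length-appendZero L)

  part-appendZero-< : ∀ L {i} → i < length L → part (appendZero L) i ≡ part L i
  part-appendZero-< (x ∷ L) {zero}  _         = refl
  part-appendZero-< (x ∷ L) {suc i} (s≤s i<n) = part-appendZero-< L i<n

  part-appendZero-≥ : ∀ L {i} → length L ≤ i → part (appendZero L) i ≡ 0
  part-appendZero-≥ []      {zero}  _         = refl
  part-appendZero-≥ []      {suc i} _         = refl
  part-appendZero-≥ (x ∷ L) {suc i} (s≤s n≤i) = part-appendZero-≥ L n≤i

  gapped-≤ : ∀ {P} → Gapped P → ∀ {i j} → i < j → j < length P → part P j + 2 ≤ part P i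
  gapped-≤ {P} P-gapped {i} {suc j} (s≤s i≤j) 1+j<n with m≤n⇒m<n∨m≡n i≤j
  ... | inj₂ refl = P-gapped i 1+j<n
  ... | inj₁ i<j  = ≤-trans (P-gapped j 1+j<n)
                     (≤-trans (m≤m+n (part P j) 2) (gapped-≤ {P} P-gapped i<j (<-trans (n<1+n j) 1+j<n)))

  module _ (t : ℕ) where

    reflect-admissible : ∀ {Q} → Admissible (2 + t) Q → Admissible (3 + t) (reflect (2 + t) Q)
    reflect-admissible {Q} adm = record
      { gap      = reflect-gapped c Q Q≤c gap
      ; bounded  = λ i i<n → s≤s (reflect-boundedBy c Q i i<n)
      ; hook≢t   = λ i j i<n j<n e → hook≢1+t _ _ (mirror-< (<n i<n)) (mirror-< (<n j<n))
                     (mirror-pair-sum c Q Q≤c (<n i<n) (<n j<n) (cong (_+ c) (suc-injective e)))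
      ; hook≢1+t = λ i j i<n j<n e → hook≢t _ _ (mirror-< (<n i<n)) (mirror-< (<n j<n))
                     (mirror-pair-sum-suc c Q Q≤c (<n i<n) (<n j<n) (trans (cong (_+ c) e) (shuffle t)))
      }
      where
      open Admissible adm
      c : ℕ
      c = 2 + t
      Q≤c : BoundedBy c Q
      Q≤c = admissible-boundedBy adm
      <n : ∀ {i} → i < length (reflect c Q) → i < length Q
      <n {i} = subst (i <_) (length-reflect c Q)
      shuffle : ∀ t → 3 + t + (2 + t) ≡ suc ((2 + t) + (2 + t))
      shuffle = solve-∀

    private
      module AppendZeroReflect {Q} (adm : Admissible t Q) where

        open Admissible adm

        c n : ℕ
        c = 1 + t
        n = length Q

        M P : List ℕ
        M = reflect c Q
        P = appendZero M

        Q≤c : BoundedBy c Q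
        Q≤c i i<n = ≤-trans (<⇒≤ (bounded i i<n)) (n≤1+n t)

        length-P : length P ≡ suc n
        length-P = trans (length-appendZero M) (cong suc (length-reflect c Q))

        <M : ∀ {i} → i < n → i < length M
        <M {i} = subst (i <_) (sym (length-reflect c Q))

        part-P-< : ∀ {i} → i < n → part P i ≡ part M i
        part-P-< i<n = part-appendZero-< M (<M i<n)

        part-P-≥ : ∀ {i} → ¬ i < n → part P i ≡ 0
        part-P-≥ {i} i≮n = part-appendZero-≥ M (subst (_≤ i) (sym (length-reflect c Q)) (≮⇒≥ i≮n))

        P≤c : ∀ i → part P i ≤ c
        P≤c i with i <? n
        ... | yes i<n = subst (_≤ c) (sym (part-P-< i<n)) (reflect-boundedBy c Q i (<M i<n))
        ... | no  i≮n = subst (_≤ c) (sym (part-P-≥ i≮n)) z≤n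

        reflected : ∀ {i j k} → i < n → j < n → part P i + part P j ≡ k → part M i + part M j ≡ k
        reflected i<n j<n = trans (sym (cong₂ _+_ (part-P-< i<n) (part-P-< j<n)))

        pair-cases : ∀ {i j} {A : Set} → (part P i + part P j ≤ c → A) → (i < n → j < n → A) → A
        pair-cases {i} {j} small both with i <? n | j <? n
        ... | yes i<n | yes j<n = both i<n j<n
        ... | no  i≮n | _       = small (subst (λ x → x + part P j ≤ c) (sym (part-P-≥ i≮n)) (P≤c j))
        ... | yes _   | no  j≮n = small (subst (λ x → part P i + x ≤ c) (sym (part-P-≥ j≮n))
                                          (subst (_≤ c) (sym (+-identityʳ _)) (P≤c i)))

        2≤M : ∀ {i} → i < n → 2 ≤ part M i
        2≤M {i} i<n = +-cancelʳ-≤ (part Q i′) 2 (part M i)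
          (subst (2 + part Q i′ ≤_) (sym (part-reflect+part c Q Q≤c i<n)) (s≤s (bounded i′ (mirror-< i<n))))
          where
          i′ : ℕ
          i′ = mirror n i

        P-gapped : Gapped P
        P-gapped i 1+i<n′ with suc i <? n
        ... | yes 1+i<n = subst₂ _≤_ (cong (_+ 2) (sym (part-P-< 1+i<n))) (sym (part-P-< (<-trans (n<1+n i) 1+i<n)))
                            (reflect-gapped c Q Q≤c gap i (<M 1+i<n))
        ... | no  1+i≮n = subst₂ _≤_ (cong (_+ 2) (sym (part-P-≥ 1+i≮n))) (sym (part-P-< i<n)) (2≤M i<n)
          where
          i<n : i < n
          i<n = ≤-pred (subst (suc i <_) length-P 1+i<n′)

        shuffle : ∀ t → (2 + t) + t ≡ (1 + t) + (1 + t)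
        shuffle = solve-∀
        shuffle′ : ∀ t → (3 + t) + t ≡ suc ((1 + t) + (1 + t))
        shuffle′ = solve-∀

        admissible : Admissible (3 + t) P
        admissible = record
          { gap      = P-gapped
          ; bounded  = λ i _ → s≤s (≤-trans (P≤c i) (n≤1+n c))
          ; hook≢t   = λ i j _ _ e → pair-cases (λ P≤ → <-irrefl refl (≤-trans (≤-reflexive (sym e)) (s≤s P≤)))
                         λ i<n j<n → hook≢1+t _ _ (mirror-< i<n) (mirror-< j<n)
                           (mirror-pair-sum c Q Q≤c i<n j<n (trans (cong (_+ t) (reflected i<n j<n (suc-injective e))) (shuffle t)))
          ; hook≢1+t = λ i j _ _ e → pair-cases (λ P≤ → <-irrefl refl (≤-trans (≤-reflexive (sym e)) (≤-trans P≤ (n≤1+n _))))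
                         λ i<n j<n → hook≢t _ _ (mirror-< i<n) (mirror-< j<n)
                           (mirror-pair-sum-suc c Q Q≤c i<n j<n (trans (cong (_+ t) (reflected i<n j<n e)) (shuffle′ t)))
          }

    appendZero-reflect-admissible : ∀ {Q} → Admissible t Q → Admissible (3 + t) (appendZero (reflect (1 + t) Q))
    appendZero-reflect-admissible = AppendZeroReflect.admissible

    unreflect-admissible : ∀ {P} → Admissible (3 + t) P → (∀ i → i < length P → 0 < part P i) →
                           Admissible (2 + t) (reflect (2 + t) P)
    unreflect-admissible {P} adm P>0 = record
      { gap      = reflect-gapped c P P≤c gap
      ; bounded  = λ i i<n → subst (_≤ c) (+-comm (part Q i) 1)
                                (part-reflect+≤ c P P≤c (<n i<n) (P>0 _ (mirror-< (<n i<n))))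
      ; hook≢t   = λ i j i<n j<n e → hook≢1+t _ _ (mirror-< (<n i<n)) (mirror-< (<n j<n))
                     (mirror-pair-sum c P P≤c (<n i<n) (<n j<n) (trans (cong (_+ (3 + t)) (suc-injective e)) (shuffle t)))
      ; hook≢1+t = λ i j i<n j<n e → hook≢t _ _ (mirror-< (<n i<n)) (mirror-< (<n j<n))
                     (mirror-pair-sum-suc c P P≤c (<n i<n) (<n j<n) (trans (cong (_+ (3 + t)) e) (shuffle′ t)))
      }
      where
      open Admissible adm
      c : ℕ
      c = 2 + t
      Q : List ℕ
      Q = reflect c P
      P≤c : BoundedBy c P
      P≤c i i<n = ≤-pred (bounded i i<n)
      <n : ∀ {i} → i < length Q → i < length P
      <n {i} = subst (i <_) (length-reflect c P)
      shuffle : ∀ t → (1 + t) + (3 + t) ≡ (2 + t) + (2 + t)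
      shuffle = solve-∀
      shuffle′ : ∀ t → (2 + t) + (3 + t) ≡ suc ((2 + t) + (2 + t))
      shuffle′ = solve-∀

    module Unappend {P} (adm : Admissible (3 + t) P) {n} (length-P : length P ≡ suc n) (last≡0 : part P n ≡ 0) where

      open Admissible adm

      private
        c : ℕ
        c = 1 + t

        init : List ℕ
        init = applyUpTo (part P) n

        length-init : length init ≡ n
        length-init = length-applyUpTo (part P) n

        <P : ∀ {i} → i < n → i < length P
        <P {i} i<n = subst (i <_) (sym length-P) (<-trans i<n (n<1+n n))

        <init⇒<n : ∀ {i} → i < length init → i < n
        <init⇒<n {i} = subst (i <_) length-init

        part-init : ∀ {i} → i < n → part init i ≡ part P i
        part-init = part-applyUpTo (part P) n

        n<P : n < length P
        n<P = subst (n <_) (sym length-P) (n<1+n n)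

        init≤c : BoundedBy c init
        init≤c i i<n′ with m≤n⇒m<n∨m≡n (≤-pred (bounded i (<P (<init⇒<n i<n′))))
        ... | inj₁ Pᵢ<2+t = subst (_≤ c) (sym (part-init (<init⇒<n i<n′))) (≤-pred Pᵢ<2+t)
        ... | inj₂ Pᵢ≡2+t = ⊥-elim (hook≢t i n (<P (<init⇒<n i<n′)) n<P
                                     (cong suc (trans (cong (part P i +_) last≡0) (trans (+-identityʳ _) Pᵢ≡2+t))))

        init≥2 : ∀ i → i < length init → 2 ≤ part init i
        init≥2 i i<n′ = subst (2 ≤_) (sym (part-init i<n))
                          (subst (λ z → z + 2 ≤ part P i) last≡0 (gapped-≤ {P} gap i<n n<P))
          where
          i<n : i < n
          i<n = <init⇒<n i<n′

        init-gapped : Gapped init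
        init-gapped i 1+i<n′ = subst₂ _≤_ (cong (_+ 2) (sym (part-init 1+i<n))) (sym (part-init (<-trans (n<1+n i) 1+i<n)))
                                 (gap i (<P 1+i<n))
          where
          1+i<n : suc i < n
          1+i<n = <init⇒<n 1+i<n′

        Q : List ℕ
        Q = reflect c init

        <m : ∀ {i} → i < length Q → i < length init
        <m {i} = subst (i <_) (length-reflect c init)

        mirror-init : ∀ {i} → i < length Q → part init (mirror (length init) i) ≡ part P (mirror (length init) i)
        mirror-init i<n′ = part-init (<init⇒<n (mirror-< (<m i<n′)))

        <P′ : ∀ {i} → i < length Q → mirror (length init) i < length P
        <P′ i<n′ = <P (<init⇒<n (mirror-< (<m i<n′)))

        shuffle : ∀ q t → suc q ≡ t → q + (3 + t) ≡ (1 + t) + (1 + t)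
        shuffle q _ refl = identity q
          where
          identity : ∀ q → q + (3 + suc q) ≡ (1 + suc q) + (1 + suc q)
          identity = solve-∀
        shuffle′ : ∀ t → t + (3 + t) ≡ suc ((1 + t) + (1 + t))
        shuffle′ = solve-∀

      unreflected-admissible : Admissible t Q
      unreflected-admissible = record
        { gap      = reflect-gapped c init init≤c init-gapped
        ; bounded  = λ i i<n → ≤-pred (subst (_≤ c) (+-comm (part Q i) 2)
                                         (part-reflect+≤ c init init≤c (<m i<n) (init≥2 _ (mirror-< (<m i<n)))))
        ; hook≢t   = λ i j i<n j<n e → hook≢1+t _ _ (<P′ i<n) (<P′ j<n)
                       (trans (sym (cong₂ _+_ (mirror-init i<n) (mirror-init j<n)))
                         (mirror-pair-sum c init init≤c (<m i<n) (<m j<n) (shuffle _ t e)))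
        ; hook≢1+t = λ i j i<n j<n e → hook≢t _ _ (<P′ i<n) (<P′ j<n)
                       (trans (sym (cong suc (cong₂ _+_ (mirror-init i<n) (mirror-init j<n))))
                         (mirror-pair-sum-suc c init init≤c (<m i<n) (<m j<n) (trans (cong (_+ (3 + t)) e) (shuffle′ t))))
        }

      appendZero-reflect-unreflected : appendZero (reflect c Q) ≡ P
      appendZero-reflect-unreflected = begin
        appendZero (reflect c (reflect c init))   ≡⟨ cong appendZero (reflect-involutive c init init≤c) ⟩
        init ∷ʳ 0                                 ≡⟨ cong (init ∷ʳ_) last≡0 ⟨
        applyUpTo (part P) n ∷ʳ part P n          ≡⟨ applyUpTo-∷ʳ (part P) n ⟩
        applyUpTo (part P) (suc n)                ≡⟨ cong (applyUpTo (part P)) length-P ⟨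
        applyUpTo (part P) (length P)             ≡⟨ applyUpTo-part P ⟩
        P                                         ∎
        where open ≡-Reasoning

  ends-in-zero-or-positive : ∀ {P} → Gapped P →
    (∃[ n ] length P ≡ suc n × part P n ≡ 0) ⊎ (∀ i → i < length P → 0 < part P i)
  ends-in-zero-or-positive {P} P-gapped = split (length P) refl
    where
    split : ∀ m → length P ≡ m → (∃[ n ] m ≡ suc n × part P n ≡ 0) ⊎ (∀ i → i < m → 0 < part P i)
    split zero    _     = inj₂ λ _ ()
    split (suc n) |P|≡ with part P n ≟ 0
    ... | yes last≡0 = inj₁ (n , refl , last≡0)
    ... | no  last≢0 = inj₂ positive
      where
      positive : ∀ i → i < suc n → 0 < part P i
      positive i (s≤s i≤n) with m≤n⇒m<n∨m≡n i≤n
      ... | inj₁ i<n  = ≤-trans (s≤s z≤n) (≤-trans (m≤n+m 2 _) (gapped-≤ {P} P-gapped i<n (subst (n <_) (sym |P|≡) ≤-refl)))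
      ... | inj₂ refl = n≢0⇒n>0 last≢0

  admissibleLists : ℕ → List (List ℕ)
  admissibleLists zero                = [] ∷ []
  admissibleLists (suc zero)          = [] ∷ []
  admissibleLists (suc (suc zero))    = [] ∷ (0 ∷ []) ∷ []
  admissibleLists (suc (suc (suc t))) =
    map (reflect (2 + t)) (admissibleLists (suc (suc t))) ++ map (appendZero ∘ reflect (1 + t)) (admissibleLists t)

  admissible-[] : ∀ t → Admissible t []
  admissible-[] t = record { gap = λ _ () ; bounded = λ _ () ; hook≢t = λ _ _ () ; hook≢1+t = λ _ _ () }

  admissible-[0] : Admissible 2 (0 ∷ [])
  admissible-[0] = record
    { gap      = λ { _ (s≤s ()) }
    ; bounded  = λ { zero _ → s≤s z≤n ; (suc _) (s≤s ()) }
    ; hook≢t   = λ { zero zero _ _ () ; zero (suc _) _ (s≤s ()) ; (suc _) _ (s≤s ()) _ }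
    ; hook≢1+t = λ { zero zero _ _ () ; zero (suc _) _ (s≤s ()) ; (suc _) _ (s≤s ()) _ }
    }

  admissibleLists-sound : ∀ t {P} → P ∈ admissibleLists t → Admissible t P
  admissibleLists-sound zero                (here refl)         = admissible-[] 0
  admissibleLists-sound (suc zero)          (here refl)         = admissible-[] 1
  admissibleLists-sound (suc (suc zero))    (here refl)         = admissible-[] 2
  admissibleLists-sound (suc (suc zero))    (there (here refl)) = admissible-[0]
  admissibleLists-sound (suc (suc (suc t))) P∈ =
    [ (λ P∈₁ → let Q , Q∈ , P≡ = ∈-map⁻ (reflect (2 + t)) P∈₁ in
        subst (Admissible (3 + t)) (sym P≡) (reflect-admissible t (admissibleLists-sound (suc (suc t)) Q∈)))
    , (λ P∈₂ → let Q , Q∈ , P≡ = ∈-map⁻ (appendZero ∘ reflect (1 + t)) P∈₂ in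
        subst (Admissible (3 + t)) (sym P≡) (appendZero-reflect-admissible t (admissibleLists-sound t Q∈)))
    ]′ (∈-++⁻ (map (reflect (2 + t)) (admissibleLists (suc (suc t)))) P∈)

  admissibleLists-complete : ∀ t {P} → Admissible t P → P ∈ admissibleLists t
  admissibleLists-complete zero {[]} _ = here refl
  admissibleLists-complete zero {_ ∷ _} adm = ⊥-elim (n≮0 (Admissible.bounded adm 0 (s≤s z≤n)))
  admissibleLists-complete (suc zero) {[]} _ = here refl
  admissibleLists-complete (suc zero) {_ ∷ _} adm with Admissible.bounded adm 0 (s≤s z≤n)
  ... | s≤s z≤n = ⊥-elim (Admissible.hook≢t adm 0 0 (s≤s z≤n) (s≤s z≤n) refl)
  admissibleLists-complete (suc (suc zero)) {[]} _ = here refl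
  admissibleLists-complete (suc (suc zero)) {_ ∷ []} adm with Admissible.bounded adm 0 (s≤s z≤n)
  ... | s≤s z≤n       = there (here refl)
  ... | s≤s (s≤s z≤n) = ⊥-elim (Admissible.hook≢1+t adm 0 0 (s≤s z≤n) (s≤s z≤n) refl)
  admissibleLists-complete (suc (suc zero)) {_ ∷ y ∷ _} adm =
    ⊥-elim (<⇒≱ (Admissible.bounded adm 0 (s≤s z≤n)) (≤-trans (m≤n+m 2 y) (Admissible.gap adm 0 (s≤s (s≤s z≤n)))))
  admissibleLists-complete (suc (suc (suc t))) {P} adm =
    [ (λ (n , length-P , last≡0) → let open Unappend t {P} adm length-P last≡0 in
        ∈-++⁺ʳ (map (reflect (2 + t)) (admissibleLists (suc (suc t))))
          (subst (_∈ _) appendZero-reflect-unreflected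
            (∈-map⁺ (appendZero ∘ reflect (1 + t)) (admissibleLists-complete t unreflected-admissible))))
    , (λ P>0 → ∈-++⁺ˡ (subst (_∈ _) (reflect-involutive (2 + t) P (λ i i<n → ≤-pred (Admissible.bounded adm i i<n)))
        (∈-map⁺ (reflect (2 + t)) (admissibleLists-complete (suc (suc t)) (unreflect-admissible t adm P>0)))))
    ]′ (ends-in-zero-or-positive {P} (Admissible.gap adm))

  map⁺-injectiveOn : ∀ {A B : Set} (f : A → B) {xs} → Unique xs →
                     (∀ {x y} → x ∈ xs → y ∈ xs → f x ≡ f y → x ≡ y) → Unique (map f xs)
  map⁺-injectiveOn f {[]}     []          _   = []
  map⁺-injectiveOn f {x ∷ xs} (x∉ ∷ uxs) inj =
    All.map⁺ (All.tabulate (λ y∈ fx≡fy → All.lookup x∉ y∈ (inj (here refl) (there y∈) fx≡fy)))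
    ∷ map⁺-injectiveOn f uxs (λ x∈ y∈ → inj (there x∈) (there y∈))

  reflect-positive : ∀ {c L} → (∀ i → i < length L → part L i < c) → ∀ i → i < length (reflect c L) → 0 < part (reflect c L) i
  reflect-positive {c} {L} L<c i i<n′ =
    +-cancelʳ-< (part L i′) 0 (part (reflect c L) i) (subst (part L i′ <_) (sym (part-reflect+part c L L≤c i<n)) (L<c i′ (mirror-< i<n)))
    where
    i<n : i < length L
    i<n = subst (i <_) (length-reflect c L) i<n′
    i′ : ℕ
    i′ = mirror (length L) i
    L≤c : BoundedBy c L
    L≤c j j<n = <⇒≤ (L<c j j<n)

  admissibleLists-unique : ∀ t → Unique (admissibleLists t)
  admissibleLists-unique zero                = [] ∷ []
  admissibleLists-unique (suc zero)          = [] ∷ []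
  admissibleLists-unique (suc (suc zero))    = ((λ ()) ∷ []) ∷ [] ∷ []
  admissibleLists-unique (suc (suc (suc t))) =
    ++⁺ (map⁺-injectiveOn (reflect (2 + t)) (admissibleLists-unique (suc (suc t))) reflect-injectiveOn)
        (map⁺-injectiveOn (appendZero ∘ reflect (1 + t)) (admissibleLists-unique t) appendZero-reflect-injectiveOn)
        disjoint
    where
    boundedBy : ∀ {t′ c Q} → t′ ≤ c → Q ∈ admissibleLists t′ → BoundedBy c Q
    boundedBy t′≤c Q∈ i i<n = ≤-trans (admissible-boundedBy (admissibleLists-sound _ Q∈) i i<n) t′≤c
    reflect-injectiveOn : ∀ {P Q} → P ∈ admissibleLists (2 + t) → Q ∈ admissibleLists (2 + t) →
                          reflect (2 + t) P ≡ reflect (2 + t) Q → P ≡ Q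
    reflect-injectiveOn P∈ Q∈ eq = trans (sym (reflect-involutive _ _ (boundedBy ≤-refl P∈)))
                                     (trans (cong (reflect (2 + t)) eq) (reflect-involutive _ _ (boundedBy ≤-refl Q∈)))
    appendZero-reflect-injectiveOn : ∀ {P Q} → P ∈ admissibleLists t → Q ∈ admissibleLists t →
                                     appendZero (reflect (1 + t) P) ≡ appendZero (reflect (1 + t) Q) → P ≡ Q
    appendZero-reflect-injectiveOn P∈ Q∈ eq =
      trans (sym (reflect-involutive _ _ (boundedBy (n≤1+n t) P∈)))
            (trans (cong (reflect (1 + t)) (proj₁ (∷ʳ-injective _ _ eq))) (reflect-involutive _ _ (boundedBy (n≤1+n t) Q∈)))
    disjoint : ∀ {v} → ¬ (v ∈ map (reflect (2 + t)) (admissibleLists (2 + t)) × v ∈ map (appendZero ∘ reflect (1 + t)) (admissibleLists t))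
    disjoint (v∈₁ , v∈₂) with ∈-map⁻ (reflect (2 + t)) v∈₁ | ∈-map⁻ (appendZero ∘ reflect (1 + t)) v∈₂
    ... | Q₁ , Q₁∈ , refl | Q₂ , _ , v≡ = <-irrefl (sym last≡0) (reflect-positive {2 + t} {Q₁} (Admissible.bounded (admissibleLists-sound (2 + t) Q₁∈)) k k<n)
      where
      M = reflect (1 + t) Q₂
      k : ℕ
      k = length M
      k<n : k < length (reflect (2 + t) Q₁)
      k<n = subst (k <_) (sym (trans (cong length v≡) (length-appendZero M))) (n<1+n k)
      last≡0 : part (reflect (2 + t) Q₁) k ≡ 0
      last≡0 = trans (cong (λ w → part w k) v≡) (part-appendZero-≥ M ≤-refl)

  sum-map-suc : ∀ {A : Set} (f : A → ℕ) xs → sum (map (suc ∘ f) xs) ≡ sum (map f xs) + length xs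
  sum-map-suc f []       = refl
  sum-map-suc f (x ∷ xs) = trans (cong (suc (f x) +_) (sum-map-suc f xs)) (trans (cong suc (sym (+-assoc (f x) _ _))) (sym (+-suc _ (length xs))))

  sum-map-+≡* : ∀ {A : Set} {f g h : A → ℕ} k xs → (∀ {x} → x ∈ xs → f x + g x ≡ k * h x) →
                sum (map f xs) + sum (map g xs) ≡ k * sum (map h xs)
  sum-map-+≡* {f = f} {g} {h} k []       _  = sym (*-zeroʳ k)
  sum-map-+≡* {f = f} {g} {h} k (x ∷ xs) eq = begin
    (f x + sum (map f xs)) + (g x + sum (map g xs))  ≡⟨ interchange (f x) _ (g x) _ ⟩
    (f x + g x) + (sum (map f xs) + sum (map g xs))  ≡⟨ cong₂ _+_ (eq (here refl)) (sum-map-+≡* k xs (eq ∘ there)) ⟩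
    k * h x + k * sum (map h xs)                     ≡⟨ *-distribˡ-+ k (h x) _ ⟨
    k * (h x + sum (map h xs))                       ∎
    where open ≡-Reasoning

  sum-map-∘ : ∀ {A B : Set} (f : B → ℕ) (g : A → B) xs → sum (map f (map g xs)) ≡ sum (map (f ∘ g) xs)
  sum-map-∘ f g xs = cong sum (sym (map-∘ xs))

  sum-map-++ : ∀ {A : Set} (f : A → ℕ) xs ys → sum (map f (xs ++ ys)) ≡ sum (map f xs) + sum (map f ys)
  sum-map-++ f xs ys = trans (cong sum (map-++ f xs ys)) (sum-++ (map f xs) (map f ys))

  diagonalHookSum-appendZero : ∀ L → diagonalHookSum (appendZero L) ≡ suc (diagonalHookSum L)
  diagonalHookSum-appendZero L = trans (sum-map-++ diagonalHook L (0 ∷ [])) (+-comm _ 1)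

  -- A part p and its complement c - p contribute (2p + 1) + (2(c - p) + 1) = 2c + 2 to the two hook sums.
  complement-hookSums : ∀ c Q → BoundedBy c Q →
    sum (map (diagonalHook ∘ (c ∸_)) Q) + diagonalHookSum Q ≡ (2 * c + 2) * length Q
  complement-hookSums c []      _   = sym (*-zeroʳ (2 * c + 2))
  complement-hookSums c (x ∷ Q) x∷Q≤c = begin
    (diagonalHook (c ∸ x) + S₁) + (diagonalHook x + S₂)   ≡⟨ interchange (diagonalHook (c ∸ x)) S₁ (diagonalHook x) S₂ ⟩
    (diagonalHook (c ∸ x) + diagonalHook x) + (S₁ + S₂)   ≡⟨ cong₂ _+_ pair (complement-hookSums c Q (λ i i<n → x∷Q≤c (suc i) (s≤s i<n))) ⟩
    (2 * c + 2) + (2 * c + 2) * length Q                  ≡⟨ *-suc (2 * c + 2) (length Q) ⟨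
    (2 * c + 2) * suc (length Q)                          ∎
    where
    open ≡-Reasoning
    S₁ S₂ : ℕ
    S₁ = sum (map (diagonalHook ∘ (c ∸_)) Q)
    S₂ = diagonalHookSum Q
    shuffle : ∀ a b → suc (a + a) + suc (b + b) ≡ 2 * (a + b) + 2
    shuffle = solve-∀
    pair : diagonalHook (c ∸ x) + diagonalHook x ≡ 2 * c + 2
    pair = trans (shuffle (c ∸ x) x) (cong (λ z → 2 * z + 2) (m∸n+n≡m (x∷Q≤c 0 (s≤s z≤n))))

  diagonalHookSum-reflect : ∀ c Q → BoundedBy c Q → diagonalHookSum (reflect c Q) + diagonalHookSum Q ≡ (2 * c + 2) * length Q
  diagonalHookSum-reflect c Q Q≤c = trans (cong (_+ diagonalHookSum Q) reverse-invariant) (complement-hookSums c Q Q≤c)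
    where
    reverse-invariant : diagonalHookSum (reflect c Q) ≡ sum (map (diagonalHook ∘ (c ∸_)) Q)
    reverse-invariant = trans (sum-↭ (↭-map⁺ diagonalHook (↭-reverse (map (c ∸_) Q)))) (sum-map-∘ diagonalHook (c ∸_) Q)

  count totalLength totalHookSum : ℕ → ℕ
  count        t = length (admissibleLists t)
  totalLength  t = sum (map length (admissibleLists t))
  totalHookSum t = sum (map diagonalHookSum (admissibleLists t))

  module _ (t : ℕ) where

    private
      A B : List (List ℕ)
      A = admissibleLists (2 + t)
      B = admissibleLists t

    count-rec : count (3 + t) ≡ count (2 + t) + count t
    count-rec = trans (length-++ (map (reflect (2 + t)) A)) (cong₂ _+_ (length-map _ A) (length-map _ B))

    totalLength-rec : totalLength (3 + t) ≡ totalLength (2 + t) + (totalLength t + count t)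
    totalLength-rec = begin
      sum (map length (map (reflect (2 + t)) A ++ map (appendZero ∘ reflect (1 + t)) B))
        ≡⟨ sum-map-++ length (map (reflect (2 + t)) A) _ ⟩
      sum (map length (map (reflect (2 + t)) A)) + sum (map length (map (appendZero ∘ reflect (1 + t)) B))
        ≡⟨ cong₂ _+_ (trans (sum-map-∘ length _ A) (cong sum (map-cong (length-reflect (2 + t)) A)))
                     (trans (sum-map-∘ length _ B) (cong sum (map-cong length-appendZero-reflect B))) ⟩
      totalLength (2 + t) + sum (map (suc ∘ length) B)
        ≡⟨ cong (totalLength (2 + t) +_) (sum-map-suc length B) ⟩
      totalLength (2 + t) + (totalLength t + count t) ∎
      where
      open ≡-Reasoning
      length-appendZero-reflect : ∀ Q → length (appendZero (reflect (1 + t) Q)) ≡ suc (length Q)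
      length-appendZero-reflect Q = trans (length-appendZero (reflect (1 + t) Q)) (cong suc (length-reflect (1 + t) Q))

    totalHookSum-rec : totalHookSum (3 + t) + totalHookSum (2 + t) + totalHookSum t ≡
                       (2 * (2 + t) + 2) * totalLength (2 + t) + ((2 * (1 + t) + 2) * totalLength t + count t)
    totalHookSum-rec = begin
      totalHookSum (3 + t) + H₂ + H₀      ≡⟨ cong (λ z → z + H₂ + H₀) (sum-map-++ diagonalHookSum (map (reflect (2 + t)) A) _) ⟩
      (Σᴬ + Σᴮ) + H₂ + H₀                 ≡⟨ cong (λ z → (Σᴬ + z) + H₂ + H₀) Σᴮ≡ ⟩
      (Σᴬ + (Σᴮ′ + count t)) + H₂ + H₀    ≡⟨ shuffle Σᴬ Σᴮ′ (count t) H₂ H₀ ⟩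
      (Σᴬ + H₂) + ((Σᴮ′ + H₀) + count t)  ≡⟨ cong₂ (λ x y → x + (y + count t)) Σᴬ+H₂ Σᴮ′+H₀ ⟩
      (2 * (2 + t) + 2) * totalLength (2 + t) + ((2 * (1 + t) + 2) * totalLength t + count t) ∎
      where
      open ≡-Reasoning
      H₂ H₀ Σᴬ Σᴮ Σᴮ′ : ℕ
      H₂ = totalHookSum (2 + t)
      H₀ = totalHookSum t
      Σᴬ = sum (map diagonalHookSum (map (reflect (2 + t)) A))
      Σᴮ = sum (map diagonalHookSum (map (appendZero ∘ reflect (1 + t)) B))
      Σᴮ′ = sum (map (diagonalHookSum ∘ reflect (1 + t)) B)
      bounded : ∀ {t′ c Q} → t′ ≤ c → Q ∈ admissibleLists t′ → BoundedBy c Q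
      bounded t′≤c Q∈ i i<n = ≤-trans (admissible-boundedBy (admissibleLists-sound _ Q∈) i i<n) t′≤c
      Σᴮ≡ : Σᴮ ≡ Σᴮ′ + count t
      Σᴮ≡ = trans (sum-map-∘ diagonalHookSum _ B)
              (trans (cong sum (map-cong (λ Q → diagonalHookSum-appendZero (reflect (1 + t) Q)) B))
                     (sum-map-suc (diagonalHookSum ∘ reflect (1 + t)) B))
      Σᴬ+H₂ : Σᴬ + H₂ ≡ (2 * (2 + t) + 2) * totalLength (2 + t)
      Σᴬ+H₂ = trans (cong (_+ H₂) (sum-map-∘ diagonalHookSum _ A))
                (sum-map-+≡* (2 * (2 + t) + 2) A (λ {Q} Q∈ → diagonalHookSum-reflect (2 + t) Q (bounded ≤-refl Q∈)))
      Σᴮ′+H₀ : Σᴮ′ + H₀ ≡ (2 * (1 + t) + 2) * totalLength t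
      Σᴮ′+H₀ = sum-map-+≡* (2 * (1 + t) + 2) B (λ {Q} Q∈ → diagonalHookSum-reflect (1 + t) Q (bounded (n≤1+n t) Q∈))
      shuffle : ∀ a b f h₂ h₀ → (a + (b + f)) + h₂ + h₀ ≡ (a + h₂) + ((b + h₀) + f)
      shuffle = solve-∀


module PowerSeries where

  open import Data.Nat using (zero; suc)
  open import Data.Integer using (ℤ; +_; 0ℤ; 1ℤ; _+_; _*_; _-_)
  open import Data.Integer.Properties
  open import Data.Integer.Tactic.RingSolver using (solve-∀)
  open import Data.List using (List; []; _∷_; map)
  open import Relation.Binary.PropositionalEquality
  open import Algebra.Properties.CommutativeSemigroup +-commutativeSemigroup using (interchange)
  open import Defs

  shift : Series → Series
  shift a zero    = 0ℤ
  shift a (suc n) = a n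

  euler : Series → Series
  euler a n = + n * a n

  one : Series
  one = coeff (1ℤ ∷ [])

  -- the coefficient list of x p′
  eulerₚ : List ℤ → List ℤ
  eulerₚ []      = []
  eulerₚ (c ∷ p) = 0ℤ ∷ (p +ₚ eulerₚ p)

  ·ₛ-cong : ∀ p {a b} → (∀ n → a n ≡ b n) → ∀ n → (p ·ₛ a) n ≡ (p ·ₛ b) n
  ·ₛ-cong []      _   _       = refl
  ·ₛ-cong (c ∷ p) a≗b zero    = cong (c *_) (a≗b 0)
  ·ₛ-cong (c ∷ p) a≗b (suc n) = cong₂ _+_ (cong (c *_) (a≗b (suc n))) (·ₛ-cong p a≗b n)

  shift-cong : ∀ {a b} → (∀ n → a n ≡ b n) → ∀ n → shift a n ≡ shift b n
  shift-cong _   zero    = refl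
  shift-cong a≗b (suc n) = a≗b n

  +ₚ-·ₛ : ∀ p q a n → ((p +ₚ q) ·ₛ a) n ≡ (p ·ₛ a) n + (q ·ₛ a) n
  +ₚ-·ₛ []      q       a n       = sym (+-identityˡ _)
  +ₚ-·ₛ (c ∷ p) []      a n       = sym (+-identityʳ _)
  +ₚ-·ₛ (c ∷ p) (d ∷ q) a zero    = *-distribʳ-+ (a 0) c d
  +ₚ-·ₛ (c ∷ p) (d ∷ q) a (suc n) =
    trans (cong₂ _+_ (*-distribʳ-+ (a (suc n)) c d) (+ₚ-·ₛ p q a n))
          (interchange (c * a (suc n)) (d * a (suc n)) ((p ·ₛ a) n) ((q ·ₛ a) n))

  scale-·ₛ : ∀ c q a n → (map (c *_) q ·ₛ a) n ≡ c * (q ·ₛ a) n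
  scale-·ₛ c []      a n       = sym (*-zeroʳ c)
  scale-·ₛ c (d ∷ q) a zero    = *-assoc c d (a 0)
  scale-·ₛ c (d ∷ q) a (suc n) =
    trans (cong₂ _+_ (*-assoc c d (a (suc n))) (scale-·ₛ c q a n)) (sym (*-distribˡ-+ c (d * a (suc n)) _))

  0∷-·ₛ : ∀ q a n → ((0ℤ ∷ q) ·ₛ a) n ≡ shift (q ·ₛ a) n
  0∷-·ₛ q a zero    = refl
  0∷-·ₛ q a (suc n) = +-identityˡ _

  ·ₛ-shift : ∀ p a n → (p ·ₛ shift a) n ≡ shift (p ·ₛ a) n
  ·ₛ-shift []      a zero          = refl
  ·ₛ-shift []      a (suc n)       = refl
  ·ₛ-shift (c ∷ p) a zero          = *-zeroʳ c
  ·ₛ-shift (c ∷ p) a (suc zero)    = trans (cong (λ z → c * a 0 + z) (·ₛ-shift p a 0)) (+-identityʳ _)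
  ·ₛ-shift (c ∷ p) a (suc (suc n)) = cong (λ z → c * a (suc n) + z) (·ₛ-shift p a (suc n))

  *ₚ-·ₛ : ∀ p q a n → ((p *ₚ q) ·ₛ a) n ≡ (p ·ₛ (q ·ₛ a)) n
  *ₚ-·ₛ []      q a n = refl
  *ₚ-·ₛ (c ∷ p) q a n =
    trans (+ₚ-·ₛ (map (c *_) q) (0ℤ ∷ (p *ₚ q)) a n) (trans (cong₂ _+_ (scale-·ₛ c q a n) (0∷-·ₛ (p *ₚ q) a n)) (tail n))
    where
    tail : ∀ n → c * (q ·ₛ a) n + shift ((p *ₚ q) ·ₛ a) n ≡ ((c ∷ p) ·ₛ (q ·ₛ a)) n
    tail zero    = +-identityʳ _
    tail (suc n) = cong (λ z → c * (q ·ₛ a) (suc n) + z) (*ₚ-·ₛ p q a n)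

  ·ₛ-+ : ∀ p a b n → (p ·ₛ (λ m → a m + b m)) n ≡ (p ·ₛ a) n + (p ·ₛ b) n
  ·ₛ-+ []      a b n       = refl
  ·ₛ-+ (c ∷ p) a b zero    = *-distribˡ-+ c (a 0) (b 0)
  ·ₛ-+ (c ∷ p) a b (suc n) =
    trans (cong₂ _+_ (*-distribˡ-+ c (a (suc n)) (b (suc n))) (·ₛ-+ p a b n))
          (interchange (c * a (suc n)) (c * b (suc n)) ((p ·ₛ a) n) ((p ·ₛ b) n))

  ·ₛ-scale : ∀ p k a n → (p ·ₛ (λ m → k * a m)) n ≡ k * (p ·ₛ a) n
  ·ₛ-scale []      k a n       = sym (*-zeroʳ k)
  ·ₛ-scale (c ∷ p) k a zero    = shuffle c k (a 0)
    where
    shuffle : ∀ c k x → c * (k * x) ≡ k * (c * x)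
    shuffle = solve-∀
  ·ₛ-scale (c ∷ p) k a (suc n) = trans (cong (λ z → c * (k * a (suc n)) + z) (·ₛ-scale p k a n)) (shuffle c k (a (suc n)) _)
    where
    shuffle : ∀ c k x u → c * (k * x) + k * u ≡ k * (c * x + u)
    shuffle = solve-∀

  ·ₛ-one : ∀ p n → (p ·ₛ one) n ≡ coeff p n
  ·ₛ-one []      zero    = refl
  ·ₛ-one []      (suc n) = refl
  ·ₛ-one (c ∷ p) zero    = *-identityʳ c
  ·ₛ-one (c ∷ p) (suc n) = trans (cong (_+ (p ·ₛ one) n) (*-zeroʳ c)) (trans (+-identityˡ _) (·ₛ-one p n))

  ·ₛ-euler : ∀ p a n → (p ·ₛ euler a) n ≡ + n * (p ·ₛ a) n - (eulerₚ p ·ₛ a) n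
  ·ₛ-euler []      a n       = sym (trans (+-identityʳ (+ n * 0ℤ)) (*-zeroʳ (+ n)))
  ·ₛ-euler (c ∷ p) a zero    = shuffle c (a 0)
    where
    shuffle : ∀ c x → c * (0ℤ * x) ≡ 0ℤ * (c * x) - 0ℤ * x
    shuffle = solve-∀
  ·ₛ-euler (c ∷ p) a (suc n) = begin
    c * (+ suc n * a (suc n)) + (p ·ₛ euler a) n
      ≡⟨ cong (λ z → c * (+ suc n * a (suc n)) + z) (·ₛ-euler p a n) ⟩
    c * (+ suc n * a (suc n)) + (+ n * (p ·ₛ a) n - (eulerₚ p ·ₛ a) n)
      ≡⟨ cong (λ m → c * (m * a (suc n)) + (+ n * (p ·ₛ a) n - (eulerₚ p ·ₛ a) n)) (pos-+ 1 n) ⟩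
    c * ((1ℤ + + n) * a (suc n)) + (+ n * (p ·ₛ a) n - (eulerₚ p ·ₛ a) n)
      ≡⟨ shuffle c (a (suc n)) (+ n) ((p ·ₛ a) n) ((eulerₚ p ·ₛ a) n) ⟩
    (1ℤ + + n) * (c * a (suc n) + (p ·ₛ a) n) - (0ℤ * a (suc n) + ((p ·ₛ a) n + (eulerₚ p ·ₛ a) n))
      ≡⟨ cong₂ (λ m z → m * (c * a (suc n) + (p ·ₛ a) n) - (0ℤ * a (suc n) + z)) (pos-+ 1 n) (+ₚ-·ₛ p (eulerₚ p) a n) ⟨
    + suc n * (c * a (suc n) + (p ·ₛ a) n) - (0ℤ * a (suc n) + ((p +ₚ eulerₚ p) ·ₛ a) n)
      ∎
    where
    open ≡-Reasoning
    shuffle : ∀ c x N u v → c * ((1ℤ + N) * x) + (N * u - v) ≡ (1ℤ + N) * (c * x + u) - (0ℤ * x + (u + v))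
    shuffle = solve-∀


module GeneratingFunctions where

  import Data.Nat as ℕ
  open import Data.Nat using (ℕ; zero; suc)
  import Data.Nat.Tactic.RingSolver as ℕ-Solver
  open import Data.Integer using (ℤ; +_; 0ℤ; 1ℤ; -1ℤ; _+_; _*_; _-_)
  open import Data.Integer.Properties using (pos-+; pos-*)
  open import Data.Integer.Tactic.RingSolver using (solve-∀)
  open import Data.List using (List; []; _∷_; map)
  open import Relation.Binary.PropositionalEquality
  open import Defs
  open Enumeration using (count; totalLength; totalHookSum; count-rec; totalLength-rec; totalHookSum-rec)
  open PowerSeries

  f₋₁ g₋₁ h₋₁ : ℕ → ℕ
  f₋₁ zero    = 1
  f₋₁ (suc t) = count t
  g₋₁ zero    = 0
  g₋₁ (suc t) = totalLength t
  h₋₁ zero    = 0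
  h₋₁ (suc t) = totalHookSum t

  F G H : Series
  F = toℤ f₋₁
  G = toℤ g₋₁
  H = toℤ h₋₁

  x³· : Series → Series
  x³· a = shift (shift (shift a))

  x³·-cong : ∀ {a b} → (∀ n → a n ≡ b n) → ∀ n → x³· a n ≡ x³· b n
  x³·-cong a≗b = shift-cong (shift-cong (shift-cong a≗b))

  ·ₛ-x³· : ∀ p a n → (p ·ₛ x³· a) n ≡ x³· (p ·ₛ a) n
  ·ₛ-x³· p a n = trans (·ₛ-shift p (shift (shift a)) n)
    (shift-cong (λ m → trans (·ₛ-shift p (shift a) m) (shift-cong (·ₛ-shift p a) m)) n)

  D₋-coefficient : ∀ a k → (D₋ ·ₛ a) (4 ℕ.+ k) ≡ a (4 ℕ.+ k) - a (3 ℕ.+ k) - a (1 ℕ.+ k)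
  D₋-coefficient a k = expand (a (4 ℕ.+ k)) (a (3 ℕ.+ k)) (a (2 ℕ.+ k)) (a (1 ℕ.+ k))
    where
    expand : ∀ x y z u → 1ℤ * x + (-1ℤ * y + (0ℤ * z + (-1ℤ * u + 0ℤ))) ≡ x - y - u
    expand = solve-∀

  D₊-coefficient : ∀ a k → (D₊ ·ₛ a) (4 ℕ.+ k) ≡ a (4 ℕ.+ k) + a (3 ℕ.+ k) + a (1 ℕ.+ k)
  D₊-coefficient a k = expand (a (4 ℕ.+ k)) (a (3 ℕ.+ k)) (a (2 ℕ.+ k)) (a (1 ℕ.+ k))
    where
    expand : ∀ x y z u → 1ℤ * x + (1ℤ * y + (0ℤ * z + (1ℤ * u + 0ℤ))) ≡ x + y + u
    expand = solve-∀

  D₋·F : ∀ n → (D₋ ·ₛ F) n ≡ one n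
  D₋·F 0 = refl
  D₋·F 1 = refl
  D₋·F 2 = refl
  D₋·F 3 = refl
  D₋·F (suc (suc (suc (suc k)))) = begin
    (D₋ ·ₛ F) (4 ℕ.+ k)                        ≡⟨ D₋-coefficient F k ⟩
    + count (3 ℕ.+ k) - + F₂ - + F₀            ≡⟨ cong (λ c → c - + F₂ - + F₀) (trans (cong +_ (count-rec k)) (pos-+ F₂ F₀)) ⟩
    (+ F₂ + + F₀) - + F₂ - + F₀                ≡⟨ cancel (+ F₂) (+ F₀) ⟩
    0ℤ                                         ∎
    where
    open ≡-Reasoning
    F₂ F₀ : ℕ
    F₂ = count (2 ℕ.+ k)
    F₀ = count k
    cancel : ∀ x y → (x + y) - x - y ≡ 0ℤ
    cancel = solve-∀

  D₋·G : ∀ n → (D₋ ·ₛ G) n ≡ x³· F n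
  D₋·G 0 = refl
  D₋·G 1 = refl
  D₋·G 2 = refl
  D₋·G 3 = refl
  D₋·G (suc (suc (suc (suc k)))) = begin
    (D₋ ·ₛ G) (4 ℕ.+ k)                        ≡⟨ D₋-coefficient G k ⟩
    + totalLength (3 ℕ.+ k) - + G₂ - + G₀      ≡⟨ cong (λ c → c - + G₂ - + G₀) (trans (cong +_ (totalLength-rec k))
                                                                              (trans (pos-+ G₂ _) (cong (λ z → + G₂ + z) (pos-+ G₀ _)))) ⟩
    (+ G₂ + (+ G₀ + + F₀)) - + G₂ - + G₀       ≡⟨ cancel (+ G₂) (+ G₀) (+ F₀) ⟩
    + F₀                                       ∎
    where
    open ≡-Reasoning
    G₂ G₀ F₀ : ℕ
    G₂ = totalLength (2 ℕ.+ k)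
    G₀ = totalLength k
    F₀ = count k
    cancel : ∀ x y z → (x + (y + z)) - x - y ≡ z
    cancel = solve-∀

  -- The coefficients 2t + 6 and 2t + 4 in the recurrence for h bring in x G′.
  W R : Series
  W m = + 2 * euler G m + + 2 * G m + F m
  R n = + 2 * shift (euler G) n + x³· W n

  D₊·H : ∀ n → (D₊ ·ₛ H) n ≡ R n
  D₊·H 0 = refl
  D₊·H 1 = refl
  D₊·H 2 = refl
  D₊·H 3 = refl
  D₊·H (suc (suc (suc (suc k)))) = begin
    (D₊ ·ₛ H) (4 ℕ.+ k)
      ≡⟨ D₊-coefficient H k ⟩
    + H₃ + + H₂ + + H₀
      ≡⟨ trans (cong (_+ + H₀) (pos-+ H₃ H₂)) (pos-+ (H₃ ℕ.+ H₂) H₀) ⟨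
    + (H₃ ℕ.+ H₂ ℕ.+ H₀)
      ≡⟨ cong +_ (trans (totalHookSum-rec k) (expand k G₂ G₀ F₀)) ⟩
    + (2 ℕ.* ((3 ℕ.+ k) ℕ.* G₂) ℕ.+ (2 ℕ.* ((1 ℕ.+ k) ℕ.* G₀) ℕ.+ 2 ℕ.* G₀ ℕ.+ F₀))
      ≡⟨ cong₂ (λ a b → a + (b + + (2 ℕ.* G₀) + + F₀)) (2*-pos-* (3 ℕ.+ k) G₂) (2*-pos-* (1 ℕ.+ k) G₀) ⟩
    + 2 * (+ (3 ℕ.+ k) * + G₂) + (+ 2 * (+ (1 ℕ.+ k) * + G₀) + + (2 ℕ.* G₀) + + F₀)
      ≡⟨ cong (λ z → + 2 * (+ (3 ℕ.+ k) * + G₂) + (+ 2 * (+ (1 ℕ.+ k) * + G₀) + z + + F₀)) (pos-* 2 G₀) ⟩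
    R (suc (suc (suc (suc k)))) ∎
    where
    open ≡-Reasoning
    H₃ H₂ H₀ G₂ G₀ F₀ : ℕ
    H₃ = totalHookSum (3 ℕ.+ k)
    H₂ = totalHookSum (2 ℕ.+ k)
    H₀ = totalHookSum k
    G₂ = totalLength (2 ℕ.+ k)
    G₀ = totalLength k
    F₀ = count k
    expand : ∀ k g₂ g₀ f₀ → (2 ℕ.* (2 ℕ.+ k) ℕ.+ 2) ℕ.* g₂ ℕ.+ ((2 ℕ.* (1 ℕ.+ k) ℕ.+ 2) ℕ.* g₀ ℕ.+ f₀)
                           ≡ 2 ℕ.* ((3 ℕ.+ k) ℕ.* g₂) ℕ.+ (2 ℕ.* ((1 ℕ.+ k) ℕ.* g₀) ℕ.+ 2 ℕ.* g₀ ℕ.+ f₀)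
    expand = ℕ-Solver.solve-∀
    2*-pos-* : ∀ m n → + (2 ℕ.* (m ℕ.* n)) ≡ + 2 * (+ m * + n)
    2*-pos-* m n = trans (pos-* 2 (m ℕ.* n)) (cong (+ 2 *_) (pos-* m n))

  *ₚD₋·F : ∀ p n → ((p *ₚ D₋) ·ₛ F) n ≡ coeff p n
  *ₚD₋·F p n = trans (*ₚ-·ₛ p D₋ F n) (trans (·ₛ-cong p D₋·F n) (·ₛ-one p n))

  *ₚD₋·G : ∀ p n → ((p *ₚ D₋) ·ₛ G) n ≡ x³· (p ·ₛ F) n
  *ₚD₋·G p n = trans (*ₚ-·ₛ p D₋ G n) (trans (·ₛ-cong p D₋·G n) (·ₛ-x³· p F n))

  *ₚD₋²·G : ∀ p n → (((p *ₚ D₋) *ₚ D₋) ·ₛ G) n ≡ x³· (coeff p) n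
  *ₚD₋²·G p n = trans (*ₚD₋·G (p *ₚ D₋) n) (x³·-cong (*ₚD₋·F p) n)

  F-generatingFunction : ∀ n → (D₋ ·ₛ F) n ≡ coeff (1ℤ ∷ []) n
  F-generatingFunction = D₋·F

  G-generatingFunction : ∀ n → ((D₋ *ₚ D₋) ·ₛ G) n ≡ coeff X³ n
  G-generatingFunction n = trans (*ₚD₋²·G (1ℤ ∷ []) n) (x³-one n)
    where
    x³-one : ∀ n → x³· (coeff (1ℤ ∷ [])) n ≡ coeff X³ n
    x³-one 0 = refl
    x³-one 1 = refl
    x³-one 2 = refl
    x³-one 3 = refl
    x³-one (suc (suc (suc (suc _)))) = refl

  D₋³ : List ℤ
  D₋³ = (D₋ *ₚ D₋) *ₚ D₋

  eulerₚ-D₋³ : eulerₚ D₋³ ≡ (map (+ 3 *_) (eulerₚ D₋) *ₚ D₋) *ₚ D₋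
  eulerₚ-D₋³ = refl

  T : Series
  T m = + m * x³· (coeff D₋) m - x³· (coeff (map (+ 3 *_) (eulerₚ D₋))) m

  D₋³·eulerG : ∀ m → (D₋³ ·ₛ euler G) m ≡ T m
  D₋³·eulerG m = trans (·ₛ-euler D₋³ G m) (cong₂ (λ x y → + m * x - y) (*ₚD₋²·G D₋ m)
    (trans (cong (λ p → (p ·ₛ G) m) eulerₚ-D₋³) (*ₚD₋²·G (map (+ 3 *_) (eulerₚ D₋)) m)))

  D₋³·W : ∀ m → (D₋³ ·ₛ W) m ≡ + 2 * T m + + 2 * x³· (coeff D₋) m + coeff (D₋ *ₚ D₋) m
  D₋³·W m = trans (·ₛ-+ D₋³ (λ j → + 2 * euler G j + + 2 * G j) F m)
    (cong₂ _+_ (trans (·ₛ-+ D₋³ (λ j → + 2 * euler G j) (λ j → + 2 * G j) m)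
                      (cong₂ _+_ (trans (·ₛ-scale D₋³ (+ 2) (euler G) m) (cong (+ 2 *_) (D₋³·eulerG m)))
                                 (trans (·ₛ-scale D₋³ (+ 2) G m) (cong (+ 2 *_) (*ₚD₋²·G D₋ m)))))
               (*ₚD₋·F (D₋ *ₚ D₋) m))

  Φ : Series
  Φ n = + 2 * shift T n + x³· (λ m → + 2 * T m + + 2 * x³· (coeff D₋) m + coeff (D₋ *ₚ D₋) m) n

  D₋³·R : ∀ n → (D₋³ ·ₛ R) n ≡ Φ n
  D₋³·R n = trans (·ₛ-+ D₋³ (λ m → + 2 * shift (euler G) m) (x³· W) n)
    (cong₂ _+_ (trans (·ₛ-scale D₋³ (+ 2) (shift (euler G)) n)
                      (cong (+ 2 *_) (trans (·ₛ-shift D₋³ (euler G) n) (shift-cong D₋³·eulerG n))))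
               (trans (·ₛ-x³· D₋³ W n) (x³·-cong D₋³·W n)))

  Φ≡N₃x³ : ∀ n → Φ n ≡ coeff (N₃ *ₚ X³) n
  Φ≡N₃x³ 0  = refl
  Φ≡N₃x³ 1  = refl
  Φ≡N₃x³ 2  = refl
  Φ≡N₃x³ 3  = refl
  Φ≡N₃x³ 4  = refl
  Φ≡N₃x³ 5  = refl
  Φ≡N₃x³ 6  = refl
  Φ≡N₃x³ 7  = refl
  Φ≡N₃x³ 8  = refl
  Φ≡N₃x³ 9  = refl
  Φ≡N₃x³ 10 = refl
  Φ≡N₃x³ 11 = refl
  Φ≡N₃x³ 12 = refl
  Φ≡N₃x³ 13 = refl
  Φ≡N₃x³ 14 = refl
  Φ≡N₃x³ 15 = refl
  Φ≡N₃x³ (suc (suc (suc (suc (suc (suc (suc (suc (suc (suc (suc (suc (suc (suc (suc (suc k)))))))))))))))) =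
    vanish (+ (15 ℕ.+ k)) (+ (13 ℕ.+ k))
    where
    vanish : ∀ x y → + 2 * (x * 0ℤ - 0ℤ) + (+ 2 * (y * 0ℤ - 0ℤ) + + 2 * 0ℤ + 0ℤ) ≡ 0ℤ
    vanish = solve-∀

  H-generatingFunction : ∀ n → ((D₊ *ₚ (D₋ *ₚ (D₋ *ₚ D₋))) ·ₛ H) n ≡ coeff (N₃ *ₚ X³) n
  H-generatingFunction n = begin
    ((D₊ *ₚ (D₋ *ₚ (D₋ *ₚ D₋))) ·ₛ H) n   ≡⟨ cong (λ p → (p ·ₛ H) n) D₊D₋³≡D₋³D₊ ⟩
    ((D₋³ *ₚ D₊) ·ₛ H) n                  ≡⟨ *ₚ-·ₛ D₋³ D₊ H n ⟩
    (D₋³ ·ₛ (D₊ ·ₛ H)) n                  ≡⟨ ·ₛ-cong D₋³ D₊·H n ⟩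
    (D₋³ ·ₛ R) n                          ≡⟨ D₋³·R n ⟩
    Φ n                                   ≡⟨ Φ≡N₃x³ n ⟩
    coeff (N₃ *ₚ X³) n                    ∎
    where
    open ≡-Reasoning
    D₊D₋³≡D₋³D₊ : D₊ *ₚ (D₋ *ₚ (D₋ *ₚ D₋)) ≡ D₋³ *ₚ D₊
    D₊D₋³≡D₋³D₊ = refl


open import Data.Nat using (ℕ; zero; suc; _+_; _∸_; _≤_; s≤s; z≤n)
open import Data.Integer using (1ℤ; +_)
open import Data.List using (List; []; _∷_; length; map)
open import Data.List.Properties using (length-map; map-cong-local)
import Data.List.Relation.Unary.All as All
open import Data.List.Membership.Propositional using (_∈_)
open import Data.List.Membership.Propositional.Properties using (∈-map⁺; ∈-map⁻)
open import Data.List.Membership.Propositional.Properties.WithK using (unique∧set⇒bag)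
open import Data.List.Relation.Binary.BagAndSetEquality using (∼bag⇒↭)
open import Data.List.Relation.Binary.Permutation.Propositional using (_↭_)
open import Data.List.Relation.Binary.Permutation.Propositional.Properties using (↭-length) renaming (map⁺ to ↭-map⁺)
open import Data.List.Relation.Unary.Unique.Propositional using (Unique)
open import Data.Nat.ListAction using (sum)
open import Data.Nat.ListAction.Properties using (sum-↭)
open import Data.Product using (Σ; _×_; _,_; proj₁; proj₂)
open import Function using (_∘_)
open import Function.Bundles using (_⇔_; mk⇔; Equivalence)
open import Relation.Binary.PropositionalEquality
open import Defs
open ArmSequences
open Extraction
open ShapeSize using (size-fromArms)
open Enumeration
open PowerSeries using (·ₛ-cong)
open GeneratingFunctions

DS-list : ℕ → List (List ℕ)
DS-list t = map fromArms (admissibleLists t)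

∈DS-list⇔DS : ∀ {t} → 1 ≤ t → ∀ λ′ → (λ′ ∈ DS-list t) ⇔ DS t λ′
∈DS-list⇔DS {t} t≥1 λ′ = mk⇔ to from
  where
  to : λ′ ∈ DS-list t → DS t λ′
  to λ′∈ with ∈-map⁻ fromArms λ′∈
  ... | P , P∈ , refl = FromAdmissible.shape∈DS (admissibleLists-sound t P∈)
  from : DS t λ′ → λ′ ∈ DS-list t
  from λ′∈DS = subst (_∈ DS-list t) (fromArms-arms t≥1 λ′∈DS)
                       (∈-map⁺ fromArms (admissibleLists-complete t (arms-admissible t≥1 λ′∈DS)))

DS-list-unique : ∀ t → Unique (DS-list t)
DS-list-unique t = map⁺-injectiveOn fromArms (admissibleLists-unique t) λ P∈ Q∈ eq →
  trans (sym (arms-fromArms P∈)) (trans (cong arms eq) (arms-fromArms Q∈))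
  where
  arms-fromArms : ∀ {P} → P ∈ admissibleLists t → arms (fromArms P) ≡ P
  arms-fromArms P∈ = FromAdmissible.arms-shape (admissibleLists-sound t P∈)

DS-list-enumerates : Enumerates DS-list
DS-list-enumerates t t≥1 = DS-list-unique t , ∈DS-list⇔DS t≥1

generatingFunction-cong : ∀ p q {s f : ℕ → ℕ} → (∀ n → s n ≡ f n) →
                          (∀ n → (p ·ₛ toℤ f) n ≡ coeff q n) → ∀ n → (p ·ₛ toℤ s) n ≡ coeff q n
generatingFunction-cong p q s≗f gf n = trans (·ₛ-cong p (cong +_ ∘ s≗f) n) (gf n)

module _ {E : ℕ → List (List ℕ)} (E-enumerates : Enumerates E) where

  private
    module _ {t} (t≥1 : 1 ≤ t) where
      E↭DS-list : E t ↭ DS-list t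
      E↭DS-list = ∼bag⇒↭ (unique∧set⇒bag (proj₁ (E-enumerates t t≥1)) (DS-list-unique t) λ {λ′} →
        mk⇔ (Equivalence.from (∈DS-list⇔DS t≥1 λ′) ∘ Equivalence.to (proj₂ (E-enumerates t t≥1) λ′))
            (Equivalence.from (proj₂ (E-enumerates t t≥1) λ′) ∘ Equivalence.to (∈DS-list⇔DS t≥1 λ′)))

      sum-map-E : ∀ (stat : List ℕ → ℕ) (arm-stat : List ℕ → ℕ) →
               (∀ {P} → P ∈ admissibleLists t → stat (fromArms P) ≡ arm-stat P) →
               sum (map stat (E t)) ≡ sum (map arm-stat (admissibleLists t))
      sum-map-E stat arm-stat stat≡ = trans (sum-↭ (↭-map⁺ stat E↭DS-list))
        (trans (sum-map-∘ stat fromArms (admissibleLists t)) (cong sum (map-cong-local (All.tabulate stat≡))))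

  fS≡f₋₁ : ∀ n → fS E n ≡ f₋₁ n
  fS≡f₋₁ zero          = refl
  fS≡f₋₁ (suc zero)    = refl
  fS≡f₋₁ (suc (suc t)) = trans (↭-length (E↭DS-list (s≤s z≤n))) (length-map fromArms (admissibleLists (suc t)))

  gS≡g₋₁ : ∀ n → gS E n ≡ g₋₁ n
  gS≡g₋₁ zero          = refl
  gS≡g₋₁ (suc zero)    = refl
  gS≡g₋₁ (suc (suc t)) = sum-map-E (s≤s z≤n) (length ∘ MD) length
    (λ P∈ → FromAdmissible.length-MD-shape (admissibleLists-sound (suc t) P∈))

  hS≡h₋₁ : ∀ n → hS E n ≡ h₋₁ n
  hS≡h₋₁ zero          = refl
  hS≡h₋₁ (suc zero)    = refl
  hS≡h₋₁ (suc (suc t)) = sum-map-E (s≤s z≤n) size _ (λ P∈ → size-fromArms (admissibleLists-sound (suc t) P∈))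

  f-rec : ∀ t → 3 ≤ t → fS E (suc t) ≡ fS E t + fS E (t ∸ 2)
  f-rec (suc (suc (suc k))) (s≤s (s≤s (s≤s z≤n))) = begin
    fS E (4 + k)                 ≡⟨ fS≡f₋₁ (4 + k) ⟩
    count (3 + k)                ≡⟨ count-rec k ⟩
    count (2 + k) + count k      ≡⟨ cong₂ _+_ (fS≡f₋₁ (3 + k)) (fS≡f₋₁ (1 + k)) ⟨
    fS E (3 + k) + fS E (1 + k)  ∎
    where open ≡-Reasoning

theorem1p2 : Σ (ℕ → List (List ℕ)) Enumerates
    × (∀ (E : ℕ → List (List ℕ)) → Enumerates E →
        (fS E 2 ≡ 1 × fS E 3 ≡ 2
          × (∀ t → 3 ≤ t → fS E (suc t) ≡ fS E t + fS E (t ∸ 2))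
          × (∀ n → (D₋ ·ₛ toℤ (fS E)) n ≡ coeff (1ℤ ∷ []) n))
        × (gS E 2 ≡ 0 × gS E 3 ≡ 1
          × (∀ n → ((D₋ *ₚ D₋) ·ₛ toℤ (gS E)) n ≡ coeff X³ n))
        × (hS E 2 ≡ 0 × hS E 3 ≡ 1
          × (∀ n → ((D₊ *ₚ (D₋ *ₚ (D₋ *ₚ D₋))) ·ₛ toℤ (hS E)) n
                     ≡ coeff (N₃ *ₚ X³) n)))
theorem1p2 = (DS-list , DS-list-enumerates) , λ E E-enumerates →
  (fS≡f₋₁ E-enumerates 2 , fS≡f₋₁ E-enumerates 3 , f-rec E-enumerates
    , generatingFunction-cong D₋ (1ℤ ∷ []) (fS≡f₋₁ E-enumerates) F-generatingFunction) ,
  (gS≡g₋₁ E-enumerates 2 , gS≡g₋₁ E-enumerates 3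
    , generatingFunction-cong (D₋ *ₚ D₋) X³ (gS≡g₋₁ E-enumerates) G-generatingFunction) ,
  (hS≡h₋₁ E-enumerates 2 , hS≡h₋₁ E-enumerates 3
    , generatingFunction-cong (D₊ *ₚ (D₋ *ₚ (D₋ *ₚ D₋))) (N₃ *ₚ X³) (hS≡h₋₁ E-enumerates) H-generatingFunction)
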